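{- Let $n\ge 1$ and let $\pi\in S_n$ have LTR-max decomposition $\pi=M_1P_1M_2P_2\cdots M_{k-1}P_{k-1}M_k$ with $M_k\neq\emptyset$ (equivalently $\pi_n=n$), and suppose $\pi\neq 12\cdots n$. Let $M'_{k-1}$ be the (possibly empty) sequence obtained from $M_{k-1}$ by removing its last entry $\mu_{k-1}$, let $M'_k$ be the (possibly empty) sequence obtained from $M_k$ by removing $n$, and let $\pi'\in S_{n-1}$ be obtained from $\pi$ by deleting $n$. Then a permutation $\sigma\in S_n$ satisfies $q(\sigma)=\pi$ if and only if exactly one of the following holds: (1) $\sigma=\tau\,\mu_{k-1}P_{k-1}M'_k$ (concatenation), where $\tau$ is an arrangement of the entries of $M_1P_1\cdots M_{k-2}P_{k-2}M'_{k-1}$ together with $n$ whose standardization is a preimage under $q$ of the standardization of the sequence $M_1P_1\cdots M_{k-2}P_{k-2}M'_{k-1}\,n$; (2) there is $\sigma'\in S_{n-1}$ with $q(\sigma')=\pi'$, with LTR-max decomposition $\sigma'=N_1R_1\cdots N_{s-1}R_{s-1}N_s$, such that $\sigma$ is obtained from $\sigma'$ by inserting $n$ in some position to the right of $N_{s-1}$ (that is, immediately after the last entry of $N_{s-1}$ or immediately after some entry of $R_{s-1}N_s$).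
   Context: $S_n$ is the set of permutations of $\{1,\dots,n\}$ in one-line notation $\pi=\pi_1\cdots\pi_n$. An entry $\pi_i$ is a left-to-right (LTR) maximum if $\pi_i>\pi_j$ for all $j<i$. The map $q:S_n\to S_n$ (the algorithm Queuesort, sorting with a queue allowing bypass) is described as follows: let $m_1,\dots,m_r$ be the LTR maxima of $\pi$ from left to right; for $i=r,r-1,\dots,1$ in this order, repeatedly swap $m_i$ with the entry immediately to its right as long as such an entry exists and is smaller than $m_i$; the result is $q(\pi)$ (e.g. $q(21543)=12435$). A preimage of $\pi$ is any $\sigma$ with $q(\sigma)=\pi$. The LTR-max decomposition of $\pi$ is the factorization $\pi=M_1P_1M_2P_2\cdots M_{k-1}P_{k-1}M_k$ into consecutive factors, where the $M_i$ are the maximal factors consisting of consecutive LTR maxima and the $P_i$ are the nonempty factors between them consisting of non-LTR-maxima; $M_1,\dots,M_{k-1}$ are nonempty, $M_k$ may be empty. When entries are removed from or collected out of a permutation, the resulting sequence is identified with a permutation via standardization (replace the $r$-th smallest value by $r$). -}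

module Defs where

open import Data.Nat using (ℕ; zero; suc; _<ᵇ_; _≡ᵇ_; _+_)
open import Data.Bool using (Bool; true; false; if_then_else_; not)
open import Data.List using (List; []; _∷_; _++_; map; upTo; filterᵇ; foldr; concat; length)
open import Data.List.Membership.Propositional using (_∈_)
open import Data.List.Relation.Unary.All using (All)
open import Data.List.Relation.Binary.Permutation.Propositional using (_↭_)
open import Data.Product using (_×_; proj₁; proj₂; _,_)
open import Data.Sum using (_⊎_)
open import Relation.Binary.PropositionalEquality using (_≡_; _≢_)
open import Relation.Nullary using (¬_)

idPerm : ℕ → List ℕ
idPerm n = map suc (upTo n)

-- σ ∈ S_n, in one-line notation
IsPerm : ℕ → List ℕ → Set
IsPerm n xs = xs ↭ idPerm n

ltrMaxFrom : ℕ → List ℕ → List ℕ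
ltrMaxFrom m [] = []
ltrMaxFrom m (x ∷ xs) = if m <ᵇ x then x ∷ ltrMaxFrom x xs else ltrMaxFrom m xs

ltrMax : List ℕ → List ℕ
ltrMax = ltrMaxFrom 0

push : ℕ → List ℕ → List ℕ
push v [] = v ∷ []
push v (y ∷ ys) = if y <ᵇ v then y ∷ push v ys else v ∷ y ∷ ys

move : ℕ → List ℕ → List ℕ
move v [] = []
move v (x ∷ xs) = if x ≡ᵇ v then push v xs else x ∷ move v xs

-- Queuesort: move m_r, then m_{r-1}, ..., then m_1
q : List ℕ → List ℕ
q xs = foldr move xs (ltrMax xs)

countLess : ℕ → List ℕ → ℕ
countLess x [] = 0
countLess x (y ∷ ys) = if y <ᵇ x then suc (countLess x ys) else countLess x ys

std : List ℕ → List ℕ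
std xs = map (λ x → suc (countLess x xs)) xs

delete : ℕ → List ℕ → List ℕ
delete v = filterᵇ (λ x → not (x ≡ᵇ v)) 

blocksConcat : List (List ℕ × List ℕ) → List ℕ
blocksConcat bs = concat (map (λ b → proj₁ b ++ proj₂ b) bs)

-- LTR-max decomposition π = M₁P₁⋯M_{k-1}P_{k-1}M_k, given as the list of
-- pairs (Mᵢ , Pᵢ) for i < k together with the final (possibly empty) M_k.
-- Since each Mᵢ (i<k) and Pᵢ is nonempty, maximality of the factors is automatic.
record LTRDecomp (π : List ℕ) (bs : List (List ℕ × List ℕ)) (Mk : List ℕ) : Set where
  field
    concat≡ : π ≡ blocksConcat bs ++ Mk
    Ms-nonempty : All (λ b → proj₁ b ≢ []) bs
    Ps-nonempty : All (λ b → proj₂ b ≢ []) bs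
    Ms-maxima : All (λ b → All (λ x → x ∈ ltrMax π) (proj₁ b)) bs
    Ps-nonmaxima : All (λ b → All (λ x → ¬ (x ∈ ltrMax π)) (proj₂ b)) bs
    Mk-maxima : All (λ x → x ∈ ltrMax π) Mk

ExactlyOne : Set → Set → Set
ExactlyOne A B = (A × ¬ B) ⊎ (¬ A × B)

module Submission where

-- Write σ = α n β.  On distinct entries Queuesort can be run as a right-to-left recursion that
-- pushes each record through the already processed tail; n is the largest record, so it travels
-- to the end and q σ = qsOnto 0 α β ∷ʳ n, i.e. q σ = π iff qsOnto 0 α β = π₀ := π without n.
-- Read β against the running maximum m of α.  Either β = β₁ y D E where y is a record followed
-- by a nonempty run D of smaller entries and E is an ascending run of records; then
-- π = Y y D E n with Y = qsOnto 0 α β₁, and since the last "maximum, non-maxima, maxima" pattern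
-- of a word is unique, Y, y, D, E n are X, μ, P, M_k: this is (1), with τ = α n β₁.  Or β = D E
-- with D below m and E ascending; then q fixes β after α, so deleting n gives a preimage of π′
-- in which β starts after the last block of maxima: this is (2).  In (1) the maximum μ is
-- followed directly by a smaller entry after n, which (2) forbids, so exactly one case holds.

open import Defs
import Algebra.Solver.Monoid
open import Data.Bool using (true; false; not; T; if_then_else_)
open import Data.Bool.Properties using (T-≡; T-not-≡)
open import Data.Empty using (⊥; ⊥-elim)
open import Data.List using (List; []; _∷_; _++_; _∷ʳ_; map; upTo; foldr; take; initLast; _∷ʳ′_)
open import Data.List.Properties
  using ( ++-monoid; ++-assoc; ++-conicalˡ; ++-identityʳ; ∷-injective; ∷ʳ-injectiveˡ
        ; map-++; map-cong; upTo-∷ʳ; filter-++; filter-all)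
open import Data.List.Membership.Propositional using (_∈_; _∉_)
open import Data.List.Membership.Propositional.Properties
  using (∈-++⁺ˡ; ∈-++⁺ʳ; ∈-++⁻; ∈-insert; ∈-map⁻; ∈-∃++; ∈-upTo⁻)
open import Data.List.Relation.Unary.All using (All; []; _∷_; lookup; tabulate)
import Data.List.Relation.Unary.All as All
import Data.List.Relation.Unary.All.Properties as All
open import Data.List.Relation.Unary.Any using (here; there)
open import Data.List.Relation.Unary.Unique.Propositional using (Unique; []; _∷_)
import Data.List.Relation.Unary.Unique.Propositional.Properties as Unique
open import Data.List.Relation.Binary.Permutation.Propositional
  using (_↭_; ↭-refl; ↭-sym; ↭-trans; prep; swap; ↭⇒↭ₛ)
import Data.List.Relation.Binary.Permutation.Propositional as ↭
import Data.List.Relation.Binary.Permutation.Propositional.Properties as Perm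
import Data.List.Relation.Binary.Permutation.Setoid.Properties as PermSetoid
open import Data.Nat using (ℕ; zero; suc; _<ᵇ_; _≡ᵇ_; _≤_; _<_; _≥_; _∸_; z≤n; s≤s)
open import Data.Nat.Properties
open import Data.List.Membership.DecPropositional _≟_ using (_∈?_)
open import Data.Product using (_×_; _,_; proj₁; proj₂; map₁; ∃-syntax)
open import Data.Sum using (_⊎_; inj₁; inj₂; [_,_])
import Data.Sum as Sum
open import Function using (_∘_)
open import Function.Bundles using (_⇔_; mk⇔; Equivalence)
open import Relation.Binary.Definitions using (tri<; tri≈; tri>)
open import Relation.Binary.PropositionalEquality
  using (_≡_; _≢_; refl; sym; trans; cong; cong₂; subst; setoid; module ≡-Reasoning)
open import Relation.Nullary using (¬_; Dec; yes; no)
open import Relation.Nullary.Decidable using (T?)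

<ᵇ≡true⇒< : ∀ {m n} → (m <ᵇ n) ≡ true → m < n
<ᵇ≡true⇒< {m} {n} eq = <ᵇ⇒< m n (Equivalence.from T-≡ eq)

<ᵇ≡false⇒≥ : ∀ {m n} → (m <ᵇ n) ≡ false → n ≤ m
<ᵇ≡false⇒≥ eq = ≮⇒≥ (λ m<n → subst T eq (<⇒<ᵇ m<n))

<⇒<ᵇ≡true : ∀ {m n} → m < n → (m <ᵇ n) ≡ true
<⇒<ᵇ≡true m<n = Equivalence.to T-≡ (<⇒<ᵇ m<n)

≥⇒<ᵇ≡false : ∀ {m n} → n ≤ m → (m <ᵇ n) ≡ false
≥⇒<ᵇ≡false {m} {n} n≤m with m <ᵇ n in eq
... | false = refl
... | true  = ⊥-elim (<⇒≱ (<ᵇ≡true⇒< eq) n≤m)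

≢⇒≡ᵇ≡false : ∀ {m n} → m ≢ n → (m ≡ᵇ n) ≡ false
≢⇒≡ᵇ≡false {m} {n} m≢n with m ≡ᵇ n in eq
... | false = refl
... | true  = ⊥-elim (m≢n (≡ᵇ⇒≡ m n (Equivalence.from T-≡ eq)))

≡ᵇ-refl : ∀ n → (n ≡ᵇ n) ≡ true
≡ᵇ-refl n = Equivalence.to T-≡ (≡⇒≡ᵇ n n refl)

module ++-Solver = Algebra.Solver.Monoid (++-monoid ℕ)

-- Distinct lists and permutations of [1..n]

Unique-resp-↭ : ∀ {xs ys : List ℕ} → xs ↭ ys → Unique xs → Unique ys
Unique-resp-↭ xs↭ys = PermSetoid.Unique-resp-↭ (setoid ℕ) (↭⇒↭ₛ xs↭ys)

Unique-++⁻ˡ : ∀ xs {ys : List ℕ} → Unique (xs ++ ys) → Unique xs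
Unique-++⁻ˡ []       _          = []
Unique-++⁻ˡ (x ∷ xs) (x∉ ∷ xs!) = All.++⁻ˡ xs x∉ ∷ Unique-++⁻ˡ xs xs!

Unique-++⁻ʳ : ∀ xs {ys : List ℕ} → Unique (xs ++ ys) → Unique ys
Unique-++⁻ʳ []       ys!       = ys!
Unique-++⁻ʳ (x ∷ xs) (_ ∷ xs!) = Unique-++⁻ʳ xs xs!

Unique-++-disjoint : ∀ xs {ys : List ℕ} {x} → Unique (xs ++ ys) → x ∈ xs → x ∉ ys
Unique-++-disjoint (x ∷ xs) (x∉ ∷ _)   (here refl) = All.All¬⇒¬Any (All.++⁻ʳ xs x∉)
Unique-++-disjoint (x ∷ xs) (_ ∷ xs!) (there x∈)  = Unique-++-disjoint xs xs! x∈

Unique-middle : ∀ xs {ys : List ℕ} {x} → Unique (xs ++ x ∷ ys) → x ∉ xs × x ∉ ys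
Unique-middle xs u = (λ x∈ → Unique-++-disjoint xs u x∈ (here refl))
                   , Unique.Unique[x∷xs]⇒x∉xs (Unique-++⁻ʳ xs u)

Unique⇒split-unique : ∀ xs xs′ {ys ys′ : List ℕ} {x} → Unique (xs ++ x ∷ ys) →
                      xs ++ x ∷ ys ≡ xs′ ++ x ∷ ys′ → xs ≡ xs′ × ys ≡ ys′
Unique⇒split-unique []       []        _         refl = refl , refl
Unique⇒split-unique []       (_ ∷ xs′) (x∉ ∷ _)  refl = ⊥-elim (All.All¬⇒¬Any x∉ (∈-insert xs′))
Unique⇒split-unique (_ ∷ xs) []        (x∉ ∷ _)  refl = ⊥-elim (All.All¬⇒¬Any x∉ (∈-insert xs))
Unique⇒split-unique (a ∷ xs) (_ ∷ xs′) (_ ∷ u)   eq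
  with refl , eq′ ← ∷-injective eq
  with refl , refl ← Unique⇒split-unique xs xs′ u eq′ = refl , refl

∈-idPerm⁻ : ∀ n {x} → x ∈ idPerm n → 0 < x × x ≤ n
∈-idPerm⁻ n x∈ with y , y∈ , refl ← ∈-map⁻ suc x∈ = s≤s z≤n , ∈-upTo⁻ y∈

idPerm-suc : ∀ k → idPerm (suc k) ≡ idPerm k ∷ʳ suc k
idPerm-suc k = trans (cong (map suc) (sym (upTo-∷ʳ k))) (map-++ suc (upTo k) (k ∷ []))

suc∉idPerm : ∀ k → suc k ∉ idPerm k
suc∉idPerm k x∈ = <-irrefl refl (s≤s (proj₂ (∈-idPerm⁻ k x∈)))

IsPerm⇒Unique : ∀ {n xs} → IsPerm n xs → Unique xs
IsPerm⇒Unique {n} p = Unique-resp-↭ (↭-sym p) (Unique.map⁺ suc-injective (Unique.upTo⁺ n))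

IsPerm-∈ : ∀ {n xs x} → IsPerm n xs → x ∈ xs → 0 < x × x ≤ n
IsPerm-∈ {n} p x∈ = ∈-idPerm⁻ n (Perm.∈-resp-↭ p x∈)

IsPerm-max∈ : ∀ {n xs} → n ≥ 1 → IsPerm n xs → n ∈ xs
IsPerm-max∈ {suc k} _ p =
  Perm.∈-resp-↭ (↭-sym p) (subst (suc k ∈_) (sym (idPerm-suc k)) (∈-insert (idPerm k)))

delete-++ : ∀ v xs ys → delete v (xs ++ ys) ≡ delete v xs ++ delete v ys
delete-++ v = filter-++ (T? ∘ λ x → not (x ≡ᵇ v))

delete-∉ : ∀ v {xs} → v ∉ xs → delete v xs ≡ xs
delete-∉ v v∉ = filter-all (T? ∘ λ x → not (x ≡ᵇ v))
  (tabulate λ {x} x∈ → Equivalence.from T-not-≡ (≢⇒≡ᵇ≡false {x} {v} λ { refl → v∉ x∈ }))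

delete-middle : ∀ v xs ys → v ∉ xs → v ∉ ys → delete v (xs ++ v ∷ ys) ≡ xs ++ ys
delete-middle v xs ys v∉xs v∉ys rewrite delete-++ v xs (v ∷ ys) | ≡ᵇ-refl v
  | delete-∉ v v∉xs | delete-∉ v v∉ys = refl

delete-last : ∀ v xs → v ∉ xs → delete v (xs ∷ʳ v) ≡ xs
delete-last v xs v∉ = trans (delete-middle v xs [] v∉ λ ()) (++-identityʳ xs)

delete-idPerm : ∀ n → delete n (idPerm n) ≡ idPerm (n ∸ 1)
delete-idPerm zero    = refl
delete-idPerm (suc k) =
  trans (cong (delete (suc k)) (idPerm-suc k)) (delete-last (suc k) (idPerm k) (suc∉idPerm k))

IsPerm-delete : ∀ {n xs} → IsPerm n xs → IsPerm (n ∸ 1) (delete n xs)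
IsPerm-delete {n} {xs} p =
  subst (delete n xs ↭_) (delete-idPerm n) (Perm.filter-↭ (T? ∘ λ x → not (x ≡ᵇ n)) p)

blocksConcat-∷ʳ : ∀ bs (b : List ℕ × List ℕ) →
                  blocksConcat (bs ∷ʳ b) ≡ blocksConcat bs ++ proj₁ b ++ proj₂ b
blocksConcat-∷ʳ []             b = ++-identityʳ _
blocksConcat-∷ʳ ((M , P) ∷ bs) b =
  trans (cong ((M ++ P) ++_) (blocksConcat-∷ʳ bs b)) (sym (++-assoc (M ++ P) (blocksConcat bs) _))

-- Running maxima and left-to-right maxima

runMax : ℕ → List ℕ → ℕ
runMax m []       = m
runMax m (x ∷ xs) = if m <ᵇ x then runMax x xs else runMax m xs

runMax-≥ : ∀ m xs → m ≤ runMax m xs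
runMax-≥ m []       = ≤-refl
runMax-≥ m (x ∷ xs) with m <ᵇ x in eq
... | true  = ≤-trans (<⇒≤ (<ᵇ≡true⇒< eq)) (runMax-≥ x xs)
... | false = runMax-≥ m xs

runMax-upper : ∀ m xs {y} → y ∈ xs → y ≤ runMax m xs
runMax-upper m (x ∷ xs) y∈ with m <ᵇ x in eq | y∈
... | true  | here refl = runMax-≥ x xs
... | true  | there y∈′ = runMax-upper x xs y∈′
... | false | here refl = ≤-trans (<ᵇ≡false⇒≥ eq) (runMax-≥ m xs)
... | false | there y∈′ = runMax-upper m xs y∈′

runMax-closed : ∀ {Q : ℕ → Set} m xs → Q m → All Q xs → Q (runMax m xs)
runMax-closed m []       Qm []          = Qm
runMax-closed m (x ∷ xs) Qm (Qx ∷ Qxs) with m <ᵇ x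
... | true  = runMax-closed x xs Qx Qxs
... | false = runMax-closed m xs Qm Qxs

runMax-++ : ∀ m xs ys → runMax m (xs ++ ys) ≡ runMax (runMax m xs) ys
runMax-++ m []       ys = refl
runMax-++ m (x ∷ xs) ys with m <ᵇ x
... | true  = runMax-++ x xs ys
... | false = runMax-++ m xs ys

runMax-dominated : ∀ m xs → All (_≤ m) xs → runMax m xs ≡ m
runMax-dominated m []       []           = refl
runMax-dominated m (x ∷ xs) (x≤m ∷ xs≤m) rewrite ≥⇒<ᵇ≡false x≤m = runMax-dominated m xs xs≤m

ltrMaxFrom-++ : ∀ m xs ys → ltrMaxFrom m (xs ++ ys) ≡ ltrMaxFrom m xs ++ ltrMaxFrom (runMax m xs) ys
ltrMaxFrom-++ m []       ys = refl
ltrMaxFrom-++ m (x ∷ xs) ys with m <ᵇ x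
... | true  = cong (x ∷_) (ltrMaxFrom-++ x xs ys)
... | false = ltrMaxFrom-++ m xs ys

ltrMaxFrom-⊆ : ∀ m xs {y} → y ∈ ltrMaxFrom m xs → y ∈ xs
ltrMaxFrom-⊆ m (x ∷ xs) y∈ with m <ᵇ x | y∈
... | true  | here refl = here refl
... | true  | there y∈′ = there (ltrMaxFrom-⊆ x xs y∈′)
... | false | y∈′       = there (ltrMaxFrom-⊆ m xs y∈′)

ltrMaxFrom-> : ∀ m xs {y} → y ∈ ltrMaxFrom m xs → m < y
ltrMaxFrom-> m (x ∷ xs) y∈ with m <ᵇ x in eq | y∈
... | true  | here refl = <ᵇ≡true⇒< eq
... | true  | there y∈′ = <-trans (<ᵇ≡true⇒< eq) (ltrMaxFrom-> x xs y∈′)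
... | false | y∈′       = ltrMaxFrom-> m xs y∈′

ltrMaxFrom-dominated : ∀ m xs → All (_≤ m) xs → ltrMaxFrom m xs ≡ []
ltrMaxFrom-dominated m []       []           = refl
ltrMaxFrom-dominated m (x ∷ xs) (x≤m ∷ xs≤m) rewrite ≥⇒<ᵇ≡false x≤m =
  ltrMaxFrom-dominated m xs xs≤m

>runMax⇒∈ltrMaxFrom : ∀ m xs x ys → runMax m xs < x → x ∈ ltrMaxFrom m (xs ++ x ∷ ys)
>runMax⇒∈ltrMaxFrom m xs x ys lt rewrite ltrMaxFrom-++ m xs (x ∷ ys) | <⇒<ᵇ≡true lt =
  ∈-++⁺ʳ (ltrMaxFrom m xs) (here refl)

∈ltrMaxFrom⇒>runMax : ∀ m xs x ys → Unique (xs ++ x ∷ ys) →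
                      x ∈ ltrMaxFrom m (xs ++ x ∷ ys) → runMax m xs < x
∈ltrMaxFrom⇒>runMax m xs x ys u x∈ rewrite ltrMaxFrom-++ m xs (x ∷ ys)
  with ∈-++⁻ (ltrMaxFrom m xs) x∈
... | inj₁ x∈xs = ⊥-elim (proj₁ (Unique-middle xs u) (ltrMaxFrom-⊆ m xs x∈xs))
... | inj₂ x∈ys = ltrMaxFrom-> (runMax m xs) (x ∷ ys) x∈ys

≤runMax⇒∉ltrMaxFrom : ∀ m xs ys {y} → Unique (xs ++ ys) → y ∈ ys → y ≤ runMax m xs →
                      y ∉ ltrMaxFrom m (xs ++ ys)
≤runMax⇒∉ltrMaxFrom m xs ys u y∈ys y≤ y∈ rewrite ltrMaxFrom-++ m xs ys
  with ∈-++⁻ (ltrMaxFrom m xs) y∈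
... | inj₁ y∈xs = Unique-++-disjoint xs u (ltrMaxFrom-⊆ m xs y∈xs) y∈ys
... | inj₂ y∈′  = <⇒≱ (ltrMaxFrom-> (runMax m xs) ys y∈′) y≤

data Ascending : ℕ → List ℕ → Set where
  []  : ∀ {m} → Ascending m []
  _∷_ : ∀ {m x xs} → m < x → Ascending x xs → Ascending m (x ∷ xs)

ltrMaxFrom-ascending : ∀ {m xs} → Ascending m xs → ltrMaxFrom m xs ≡ xs
ltrMaxFrom-ascending []                   = refl
ltrMaxFrom-ascending (_∷_ {x = x} m<x asc) rewrite <⇒<ᵇ≡true m<x =
  cong (x ∷_) (ltrMaxFrom-ascending asc)

Ascending-weaken : ∀ {m m′ xs} → m′ ≤ m → Ascending m xs → Ascending m′ xs
Ascending-weaken m′≤m []          = []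
Ascending-weaken m′≤m (m<x ∷ asc) = ≤-<-trans m′≤m m<x ∷ asc

Ascending-∷ʳ : ∀ {m xs y} → m < y → All (_< y) xs → Ascending m xs → Ascending m (xs ∷ʳ y)
Ascending-∷ʳ m<y []            []          = m<y ∷ []
Ascending-∷ʳ m<y (x<y ∷ xs<y) (m<x ∷ asc) = m<x ∷ Ascending-∷ʳ x<y xs<y asc

nonRecords++records : ∀ m D E → Unique (D ++ E) →
  All (_∉ ltrMaxFrom m (D ++ E)) D → All (_∈ ltrMaxFrom m (D ++ E)) E → All (_≤ m) D × Ascending m E
nonRecords++records m []      []      _        []        []        = [] , []
nonRecords++records m []      (e ∷ E) (e∉ ∷ u) []        (e∈ ∷ E∈) with m <ᵇ e in eq
... | false = ⊥-elim (All.All¬⇒¬Any e∉ (ltrMaxFrom-⊆ m E e∈))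
... | true  = [] , <ᵇ≡true⇒< eq ∷ proj₂ (nonRecords++records e [] E u []
                                           (tabulate λ x∈ → dropHead x∈ (lookup E∈ x∈)))
  where
  dropHead : ∀ {x} → x ∈ E → x ∈ e ∷ ltrMaxFrom e E → x ∈ ltrMaxFrom e E
  dropHead x∈E (here refl) = ⊥-elim (All.All¬⇒¬Any e∉ x∈E)
  dropHead _   (there x∈)  = x∈
nonRecords++records m (d ∷ D) E       (_ ∷ u)  (d∉ ∷ D∉) E∈        with m <ᵇ d in eq
... | true  = ⊥-elim (d∉ (here refl))
... | false = map₁ (<ᵇ≡false⇒≥ eq ∷_) (nonRecords++records m D E u D∉ E∈)

-- Queuesort

push-↭ : ∀ v zs → push v zs ↭ v ∷ zs
push-↭ v []       = ↭-refl
push-↭ v (z ∷ zs) with z <ᵇ v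
... | true  = ↭-trans (prep z (push-↭ v zs)) (swap z v ↭-refl)
... | false = ↭-refl

push-++-larger : ∀ {v y} zs ws → v < y → push v (zs ++ y ∷ ws) ≡ push v zs ++ y ∷ ws
push-++-larger {v} {y} []       ws v<y rewrite ≥⇒<ᵇ≡false {y} {v} (<⇒≤ v<y) = refl
push-++-larger {v}     (z ∷ zs) ws v<y with z <ᵇ v
... | true  = cong (z ∷_) (push-++-larger zs ws v<y)
... | false = refl

push-past-smaller : ∀ v zs → All (_< v) zs → push v zs ≡ zs ∷ʳ v
push-past-smaller v []       []           = refl
push-past-smaller v (z ∷ zs) (z<v ∷ zs<v) rewrite <⇒<ᵇ≡true z<v =
  cong (z ∷_) (push-past-smaller v zs zs<v)

push-ascending : ∀ {v zs} → Ascending v zs → push v zs ≡ v ∷ zs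
push-ascending     []                  = refl
push-ascending {v} (_∷_ {x = z} v<z _) rewrite ≥⇒<ᵇ≡false {z} {v} (<⇒≤ v<z) = refl

-- Queuesort by recursion on the word: the tail is processed first, and then the head is pushed
-- if it exceeds the running maximum m.  qsOnto starts from an already processed tail zs.
qsOnto : ℕ → List ℕ → List ℕ → List ℕ
qsOnto m []       zs = zs
qsOnto m (y ∷ ys) zs = if m <ᵇ y then push y (qsOnto y ys zs) else y ∷ qsOnto m ys zs

qs : ℕ → List ℕ → List ℕ
qs m xs = qsOnto m xs []

qsOnto-↭ : ∀ m xs zs → qsOnto m xs zs ↭ xs ++ zs
qsOnto-↭ m []       zs = ↭-refl
qsOnto-↭ m (y ∷ ys) zs with m <ᵇ y
... | true  = ↭-trans (push-↭ y (qsOnto y ys zs)) (prep y (qsOnto-↭ y ys zs))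
... | false = prep y (qsOnto-↭ m ys zs)

qs-↭ : ∀ m xs → qs m xs ↭ xs
qs-↭ m xs = subst (qs m xs ↭_) (++-identityʳ xs) (qsOnto-↭ m xs [])

qsOnto-++ : ∀ m xs ys zs → qsOnto m (xs ++ ys) zs ≡ qsOnto m xs (qsOnto (runMax m xs) ys zs)
qsOnto-++ m []       ys zs = refl
qsOnto-++ m (x ∷ xs) ys zs with m <ᵇ x
... | true  = cong (push x) (qsOnto-++ x xs ys zs)
... | false = cong (x ∷_) (qsOnto-++ m xs ys zs)

qsOnto-record : ∀ {m y} ys zs → m < y → qsOnto m (y ∷ ys) zs ≡ push y (qsOnto y ys zs)
qsOnto-record ys zs m<y rewrite <⇒<ᵇ≡true m<y = refl

qsOnto-++-larger : ∀ {y} m xs zs ws → All (_< y) xs →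
                   qsOnto m xs (zs ++ y ∷ ws) ≡ qsOnto m xs zs ++ y ∷ ws
qsOnto-++-larger m []       zs ws []           = refl
qsOnto-++-larger m (x ∷ xs) zs ws (x<y ∷ xs<y) with m <ᵇ x
... | true  = trans (cong (push x) (qsOnto-++-larger x xs zs ws xs<y))
                    (push-++-larger (qsOnto x xs zs) ws x<y)
... | false = cong (x ∷_) (qsOnto-++-larger m xs zs ws xs<y)

qs-dominated : ∀ m xs → All (_≤ m) xs → qs m xs ≡ xs
qs-dominated m []       []           = refl
qs-dominated m (x ∷ xs) (x≤m ∷ xs≤m) rewrite ≥⇒<ᵇ≡false x≤m =
  cong (x ∷_) (qs-dominated m xs xs≤m)

qs-ascending : ∀ {m xs} → Ascending m xs → qs m xs ≡ xs
qs-ascending []                      = refl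
qs-ascending (_∷_ {x = x} m<x asc) rewrite <⇒<ᵇ≡true m<x | qs-ascending asc = push-ascending asc

qs-dominated++ascending : ∀ m D E → All (_≤ m) D → Ascending m E → qs m (D ++ E) ≡ D ++ E
qs-dominated++ascending m []      E []           asc = qs-ascending asc
qs-dominated++ascending m (d ∷ D) E (d≤m ∷ D≤m) asc rewrite ≥⇒<ᵇ≡false d≤m =
  cong (d ∷_) (qs-dominated++ascending m D E D≤m asc)

qs-dominated-tail : ∀ m xs D E → All (_≤ runMax m xs) D → Ascending (runMax m xs) E →
                    qs m (xs ++ D ++ E) ≡ qsOnto m xs (D ++ E)
qs-dominated-tail m xs D E D≤ asc =
  trans (qsOnto-++ m xs (D ++ E) []) (cong (qsOnto m xs) (qs-dominated++ascending _ D E D≤ asc))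

qs-largest-last : ∀ m xs y ys → m < y → All (_< y) xs → All (_< y) ys →
                  qs m (xs ++ y ∷ ys) ≡ qsOnto m xs ys ∷ʳ y
qs-largest-last m xs y ys m<y xs<y ys<y = begin
  qs m (xs ++ y ∷ ys)                     ≡⟨ qsOnto-++ m xs (y ∷ ys) [] ⟩
  qsOnto m xs (qs (runMax m xs) (y ∷ ys)) ≡⟨ cong (qsOnto m xs) (qsOnto-record ys [] (runMax-closed m xs m<y xs<y)) ⟩
  qsOnto m xs (push y (qs y ys))          ≡⟨ cong (qsOnto m xs ∘ push y) (qs-dominated y ys (All.map <⇒≤ ys<y)) ⟩
  qsOnto m xs (push y ys)                 ≡⟨ cong (qsOnto m xs) (push-past-smaller y ys ys<y) ⟩
  qsOnto m xs (ys ++ y ∷ [])              ≡⟨ qsOnto-++-larger m xs ys [] xs<y ⟩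
  qsOnto m xs ys ∷ʳ y                     ∎
  where open ≡-Reasoning

moves-skip : ∀ x zs vs → x ∉ vs → foldr move (x ∷ zs) vs ≡ x ∷ foldr move zs vs
moves-skip x zs []       _  = refl
moves-skip x zs (v ∷ vs) x∉ rewrite moves-skip x zs vs (x∉ ∘ there) | ≢⇒≡ᵇ≡false (x∉ ∘ here) = refl

moves≡qs : ∀ m xs → Unique xs → foldr move xs (ltrMaxFrom m xs) ≡ qs m xs
moves≡qs m []       _        = refl
moves≡qs m (y ∷ ys) (y∉ ∷ u) with m <ᵇ y
... | true  rewrite moves-skip y ys (ltrMaxFrom y ys) (All.All¬⇒¬Any y∉ ∘ ltrMaxFrom-⊆ y ys)
                  | ≡ᵇ-refl y | moves≡qs y ys u = refl
... | false rewrite moves-skip y ys (ltrMaxFrom m ys) (All.All¬⇒¬Any y∉ ∘ ltrMaxFrom-⊆ m ys) =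
  cong (y ∷_) (moves≡qs m ys u)

q≡qs : ∀ xs → Unique xs → q xs ≡ qs 0 xs
q≡qs = moves≡qs 0

q-↭ : ∀ {xs} → Unique xs → q xs ↭ xs
q-↭ {xs} u = subst (_↭ xs) (sym (q≡qs xs u)) (qs-↭ 0 xs)

-- Standardisation

countLess-mono : ∀ {x y} zs → x ≤ y → countLess x zs ≤ countLess y zs
countLess-mono []       x≤y = z≤n
countLess-mono {x} {y} (z ∷ zs) x≤y with z <ᵇ x in eqx | z <ᵇ y in eqy
... | true  | true  = s≤s (countLess-mono zs x≤y)
... | true  | false = ⊥-elim (<⇒≱ (<-≤-trans (<ᵇ≡true⇒< eqx) x≤y) (<ᵇ≡false⇒≥ eqy))
... | false | true  = m≤n⇒m≤1+n (countLess-mono zs x≤y)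
... | false | false = countLess-mono zs x≤y

countLess-strict : ∀ {x y} zs → x < y → x ∈ zs → countLess x zs < countLess y zs
countLess-strict {x} {y} (z ∷ zs) x<y (here refl) rewrite <⇒<ᵇ≡true x<y | ≥⇒<ᵇ≡false {x} {x} ≤-refl =
  s≤s (countLess-mono zs (<⇒≤ x<y))
countLess-strict {x} {y} (z ∷ zs) x<y (there x∈) with z <ᵇ x in eqx | z <ᵇ y in eqy
... | true  | true  = s≤s (countLess-strict zs x<y x∈)
... | true  | false = ⊥-elim (<⇒≱ (<-trans (<ᵇ≡true⇒< eqx) x<y) (<ᵇ≡false⇒≥ eqy))
... | false | true  = m≤n⇒m≤1+n (countLess-strict zs x<y x∈)
... | false | false = countLess-strict zs x<y x∈

countLess-↭ : ∀ x {zs zs′} → zs ↭ zs′ → countLess x zs ≡ countLess x zs′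
countLess-↭ x ↭.refl = refl
countLess-↭ x (prep z p) with z <ᵇ x
... | true  = cong suc (countLess-↭ x p)
... | false = countLess-↭ x p
countLess-↭ x (swap a b p) with a <ᵇ x | b <ᵇ x
... | true  | true  = cong (suc ∘ suc) (countLess-↭ x p)
... | true  | false = cong suc (countLess-↭ x p)
... | false | true  = cong suc (countLess-↭ x p)
... | false | false = countLess-↭ x p
countLess-↭ x (↭.trans p p′) = trans (countLess-↭ x p) (countLess-↭ x p′)

rank : List ℕ → ℕ → ℕ
rank zs x = suc (countLess x zs)

rank-↭ : ∀ {zs zs′} → zs ↭ zs′ → ∀ x → rank zs x ≡ rank zs′ x
rank-↭ p x = cong suc (countLess-↭ x p)

rank-<ᵇ : ∀ zs {x y} → x ∈ zs → y ∈ zs → (x <ᵇ y) ≡ (rank zs x <ᵇ rank zs y)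
rank-<ᵇ zs {x} {y} x∈ y∈ with <-cmp x y
... | tri< x<y _ _ rewrite <⇒<ᵇ≡true x<y | <⇒<ᵇ≡true (s≤s (countLess-strict zs x<y x∈)) = refl
... | tri≈ _ refl _ rewrite ≥⇒<ᵇ≡false {x} {x} ≤-refl | ≥⇒<ᵇ≡false {rank zs x} {rank zs x} ≤-refl = refl
... | tri> _ _ y<x rewrite ≥⇒<ᵇ≡false (<⇒≤ y<x) | ≥⇒<ᵇ≡false (<⇒≤ (s≤s (countLess-strict zs y<x y∈))) = refl

rank-injective : ∀ zs {x y} → x ∈ zs → y ∈ zs → rank zs x ≡ rank zs y → x ≡ y
rank-injective zs {x} {y} x∈ y∈ eq with <-cmp x y
... | tri< x<y _ _ = ⊥-elim (<-irrefl eq (s≤s (countLess-strict zs x<y x∈)))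
... | tri≈ _ x≡y _ = x≡y
... | tri> _ _ y<x = ⊥-elim (<-irrefl (sym eq) (s≤s (countLess-strict zs y<x y∈)))

module _ (f : ℕ → ℕ) where

  push-map : ∀ v zs → (∀ {z} → z ∈ zs → (z <ᵇ v) ≡ (f z <ᵇ f v)) →
             push (f v) (map f zs) ≡ map f (push v zs)
  push-map v []       _    = refl
  push-map v (z ∷ zs) mono rewrite sym (mono (here refl)) with z <ᵇ v
  ... | true  = cong (f z ∷_) (push-map v zs (mono ∘ there))
  ... | false = refl

  qs-map : ∀ m m′ xs → (∀ {y} → y ∈ xs → (m <ᵇ y) ≡ (m′ <ᵇ f y)) →
           (∀ {x y} → x ∈ xs → y ∈ xs → (x <ᵇ y) ≡ (f x <ᵇ f y)) → qs m′ (map f xs) ≡ map f (qs m xs)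
  qs-map m m′ []       _     _    = refl
  qs-map m m′ (y ∷ ys) monoᵐ mono rewrite sym (monoᵐ (here refl)) with m <ᵇ y
  ... | true  rewrite qs-map y (f y) ys (mono (here refl) ∘ there) (λ x∈ y∈ → mono (there x∈) (there y∈)) =
    push-map y (qs y ys) (λ z∈ → mono (there (Perm.∈-resp-↭ (qs-↭ y ys) z∈)) (here refl))
  ... | false = cong (f y ∷_) (qs-map m m′ ys (monoᵐ ∘ there) (λ x∈ y∈ → mono (there x∈) (there y∈)))

  Unique-map : ∀ xs → (∀ {x y} → x ∈ xs → y ∈ xs → f x ≡ f y → x ≡ y) → Unique xs → Unique (map f xs)
  Unique-map []       _   []       = []
  Unique-map (x ∷ xs) inj (x∉ ∷ u) =
    All.map⁺ (All.tabulate λ y∈ fx≡fy →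
      All.All¬⇒¬Any x∉ (subst (_∈ xs) (sym (inj (here refl) (there y∈) fx≡fy)) y∈))
    ∷ Unique-map xs (λ x∈ y∈ → inj (there x∈) (there y∈)) u

  map-injectiveOn : ∀ zs xs ys → (∀ {x y} → x ∈ zs → y ∈ zs → f x ≡ f y → x ≡ y) →
                    (∀ {x} → x ∈ xs → x ∈ zs) → (∀ {y} → y ∈ ys → y ∈ zs) → map f xs ≡ map f ys → xs ≡ ys
  map-injectiveOn zs []       []       _   _   _   _  = refl
  map-injectiveOn zs (x ∷ xs) (y ∷ ys) inj xs⊆ ys⊆ eq with fx≡fy , eq′ ← ∷-injective eq
    with refl ← inj (xs⊆ (here refl)) (ys⊆ (here refl)) fx≡fy =
    cong (x ∷_) (map-injectiveOn zs xs ys inj (xs⊆ ∘ there) (ys⊆ ∘ there) eq′)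

q-std : ∀ τ → Unique τ → All (0 <_) τ → q (std τ) ≡ std (q τ)
q-std τ u τ>0 = begin
  q (map (rank τ) τ)        ≡⟨ q≡qs _ (Unique-map (rank τ) τ (rank-injective τ) u) ⟩
  qs 0 (map (rank τ) τ)     ≡⟨ qs-map (rank τ) 0 0 τ (λ y∈ → <⇒<ᵇ≡true (lookup τ>0 y∈)) (rank-<ᵇ τ) ⟩
  map (rank τ) (qs 0 τ)     ≡⟨ cong (map (rank τ)) (sym (q≡qs τ u)) ⟩
  map (rank τ) (q τ)        ≡⟨ map-cong (rank-↭ (↭-sym (q-↭ u))) (q τ) ⟩
  map (rank (q τ)) (q τ)    ∎
  where open ≡-Reasoning

std-injective : ∀ τ xs ys → Unique τ → xs ↭ τ → ys ↭ τ → std xs ≡ std ys → xs ≡ ys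
std-injective τ xs ys u xs↭τ ys↭τ eq =
  map-injectiveOn (rank τ) τ xs ys (rank-injective τ) (Perm.∈-resp-↭ xs↭τ) (Perm.∈-resp-↭ ys↭τ) (begin
    map (rank τ) xs   ≡⟨ map-cong (rank-↭ (↭-sym xs↭τ)) xs ⟩
    std xs            ≡⟨ eq ⟩
    std ys            ≡⟨ map-cong (rank-↭ ys↭τ) ys ⟩
    map (rank τ) ys   ∎)
  where open ≡-Reasoning

-- LTRDecomp with "is a left-to-right maximum" abstracted to a predicate Mx, so that a prefix
-- of a word can be decomposed with respect to the maxima of the whole word.
module Blocks (Mx : ℕ → Set) where

  record IsBlockDecomposition (L : List ℕ) (bs : List (List ℕ × List ℕ)) (Mk : List ℕ) : Set where
    field
      concat≡      : L ≡ blocksConcat bs ++ Mk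
      Ms-nonempty  : All (λ b → proj₁ b ≢ []) bs
      Ps-nonempty  : All (λ b → proj₂ b ≢ []) bs
      Ms-maxima    : All (λ b → All Mx (proj₁ b)) bs
      Ps-nonmaxima : All (λ b → All (λ x → ¬ Mx x) (proj₂ b)) bs
      Mk-maxima    : All Mx Mk

  open IsBlockDecomposition

  final : ∀ {Mk} → All Mx Mk → IsBlockDecomposition Mk [] Mk
  final Mk-mx = record { concat≡ = refl ; Ms-nonempty = [] ; Ps-nonempty = [] ; Ms-maxima = []
                       ; Ps-nonmaxima = [] ; Mk-maxima = Mk-mx }

  consMx : ∀ {x L bs Mk} → Mx x → IsBlockDecomposition L bs Mk →
           ∃[ bs′ ] ∃[ Mk′ ] IsBlockDecomposition (x ∷ L) bs′ Mk′
  consMx {bs = []} mx d = [] , _ , record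
    { concat≡ = cong (_ ∷_) (concat≡ d) ; Ms-nonempty = [] ; Ps-nonempty = [] ; Ms-maxima = []
    ; Ps-nonmaxima = [] ; Mk-maxima = mx ∷ Mk-maxima d }
  consMx {x} {bs = (M , P) ∷ bs} mx d
    with _ ∷ Ms-ne ← Ms-nonempty d | P-ne ∷ Ps-ne ← Ps-nonempty d
       | M-mx ∷ Ms-mx ← Ms-maxima d | P-nmx ∷ Ps-nmx ← Ps-nonmaxima d =
    (x ∷ M , P) ∷ bs , _ , record
      { concat≡ = cong (x ∷_) (concat≡ d) ; Ms-nonempty = (λ ()) ∷ Ms-ne ; Ps-nonempty = P-ne ∷ Ps-ne
      ; Ms-maxima = (mx ∷ M-mx) ∷ Ms-mx ; Ps-nonmaxima = P-nmx ∷ Ps-nmx ; Mk-maxima = Mk-maxima d }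

  consBlock : ∀ {x y N L bs Mk} → Mx x → All (λ z → ¬ Mx z) (y ∷ N) → IsBlockDecomposition L bs Mk →
              IsBlockDecomposition (x ∷ y ∷ N ++ L) ((x ∷ [] , y ∷ N) ∷ bs) Mk
  consBlock {x} {y} {N} {L} mx N-nmx d = record
    { concat≡      = cong (λ l → x ∷ y ∷ l) (trans (cong (N ++_) (concat≡ d)) (sym (++-assoc N _ _)))
    ; Ms-nonempty  = (λ ()) ∷ Ms-nonempty d
    ; Ps-nonempty  = (λ ()) ∷ Ps-nonempty d
    ; Ms-maxima    = (mx ∷ []) ∷ Ms-maxima d
    ; Ps-nonmaxima = N-nmx ∷ Ps-nonmaxima d
    ; Mk-maxima    = Mk-maxima d }

  module _ (Mx? : ∀ x → Dec (Mx x)) where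

    decompose′ : ∀ L → ∃[ N₀ ] ∃[ rest ] ∃[ bs ] ∃[ Mk ]
                 (L ≡ N₀ ++ rest × All (λ x → ¬ Mx x) N₀ × IsBlockDecomposition rest bs Mk)
    decompose′ []      = [] , [] , [] , [] , refl , [] , final []
    decompose′ (x ∷ L) with decompose′ L | Mx? x
    ... | N₀ , rest , bs , Mk , refl , N₀-nmx , d | no nmx = x ∷ N₀ , rest , bs , Mk , refl , nmx ∷ N₀-nmx , d
    ... | [] , rest , bs , Mk , refl , [] , d | yes mx with bs′ , Mk′ , d′ ← consMx mx d =
      [] , x ∷ rest , bs′ , Mk′ , refl , [] , d′
    ... | y ∷ N₀ , rest , bs , Mk , refl , N₀-nmx , d | yes mx = [] , _ , _ , Mk , refl , [] , consBlock mx N₀-nmx d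

    decompose : ∀ L → All Mx (take 1 L) → ∃[ bs ] ∃[ Mk ] IsBlockDecomposition L bs Mk
    decompose L head-mx with decompose′ L
    ... | [] , _ , bs , Mk , refl , _ , d = bs , Mk , d
    ... | y ∷ _ , _ , _ , _ , refl , y-nmx ∷ _ , _ with y-mx ∷ _ ← head-mx = ⊥-elim (y-nmx y-mx)

    -- α ends to the right of the last M-block N of α ++ v, so an entry inserted between α
    -- and v lands in R_{s-1} N_s.
    AfterLastBlock : List ℕ → List ℕ → Set
    AfterLastBlock α v = ∃[ cs₀ ] ∃[ N ] ∃[ R ] ∃[ Ns ] ∃[ u ]
      (IsBlockDecomposition (α ++ v) (cs₀ ∷ʳ (N , R)) Ns × R ++ Ns ≡ u ++ v × α ≡ blocksConcat cs₀ ++ N ++ u)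

    private
      take-1-++ : ∀ α {rest} → All Mx (take 1 (α ++ rest)) → All Mx (take 1 α)
      take-1-++ []      _       = []
      take-1-++ (_ ∷ _) head-mx = head-mx

      open ++-Solver

      newLastBlock : ∀ {α bsα Mα D E} → IsBlockDecomposition α bsα Mα → Mα ≢ [] → D ≢ [] →
                     All (λ x → ¬ Mx x) D → All Mx E → AfterLastBlock α (D ++ E)
      newLastBlock {α} {bsα} {Mα} {D} {E} dα Mα≢[] D≢[] D-nmx E-mx =
        bsα , Mα , D , E , [] , record
          { concat≡      = trans (cong (_++ D ++ E) (concat≡ dα)) (begin
              (blocksConcat bsα ++ Mα) ++ D ++ E  ≡⟨ solve 4 (λ b m d e → (b ⊕ m) ⊕ d ⊕ e ⊜ (b ⊕ m ⊕ d) ⊕ e)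
                                                         refl (blocksConcat bsα) Mα D E ⟩
              (blocksConcat bsα ++ Mα ++ D) ++ E  ≡⟨ cong (_++ E) (sym (blocksConcat-∷ʳ bsα (Mα , D))) ⟩
              blocksConcat (bsα ∷ʳ (Mα , D)) ++ E ∎)
          ; Ms-nonempty  = All.∷ʳ⁺ (Ms-nonempty dα) Mα≢[]
          ; Ps-nonempty  = All.∷ʳ⁺ (Ps-nonempty dα) D≢[]
          ; Ms-maxima    = All.∷ʳ⁺ (Ms-maxima dα) (Mk-maxima dα)
          ; Ps-nonmaxima = All.∷ʳ⁺ (Ps-nonmaxima dα) D-nmx
          ; Mk-maxima    = E-mx }
        , refl , trans (concat≡ dα) (cong (blocksConcat bsα ++_) (sym (++-identityʳ Mα)))
        where open ≡-Reasoning

      extendLastBlock : ∀ {α bs N R D E} → IsBlockDecomposition α (bs ∷ʳ (N , R)) [] →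
                        All (λ x → ¬ Mx x) D → All Mx E → AfterLastBlock α (D ++ E)
      extendLastBlock {α} {bs} {N} {R} {D} {E} dα D-nmx E-mx
        with Ms-ne , N≢[] ← All.∷ʳ⁻ (Ms-nonempty dα) | Ps-ne , R≢[] ← All.∷ʳ⁻ (Ps-nonempty dα)
           | Ms-mx , N-mx ← All.∷ʳ⁻ (Ms-maxima dα)   | Ps-nmx , R-nmx ← All.∷ʳ⁻ (Ps-nonmaxima dα) =
        bs , N , R ++ D , E , R , record
          { concat≡      = trans (cong (_++ D ++ E) α≡) (begin
              (blocksConcat bs ++ N ++ R) ++ D ++ E    ≡⟨ solve 5 (λ b n r d e → (b ⊕ n ⊕ r) ⊕ d ⊕ e ⊜ (b ⊕ n ⊕ r ⊕ d) ⊕ e)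
                                                              refl (blocksConcat bs) N R D E ⟩
              (blocksConcat bs ++ N ++ R ++ D) ++ E    ≡⟨ cong (_++ E) (sym (blocksConcat-∷ʳ bs (N , R ++ D))) ⟩
              blocksConcat (bs ∷ʳ (N , R ++ D)) ++ E   ∎)
          ; Ms-nonempty  = All.∷ʳ⁺ Ms-ne N≢[]
          ; Ps-nonempty  = All.∷ʳ⁺ Ps-ne (R≢[] ∘ ++-conicalˡ R D)
          ; Ms-maxima    = All.∷ʳ⁺ Ms-mx N-mx
          ; Ps-nonmaxima = All.∷ʳ⁺ Ps-nmx (All.++⁺ R-nmx D-nmx)
          ; Mk-maxima    = E-mx }
        , ++-assoc R D E , α≡
        where
        open ≡-Reasoning
        α≡ : α ≡ blocksConcat bs ++ N ++ R
        α≡ = trans (concat≡ dα) (trans (++-identityʳ _) (blocksConcat-∷ʳ bs (N , R)))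

      absorbFinalBlock : ∀ {α bs N R Mα E} → IsBlockDecomposition α (bs ∷ʳ (N , R)) Mα →
                         All Mx E → AfterLastBlock α E
      absorbFinalBlock {α} {bs} {N} {R} {Mα} {E} dα E-mx =
        bs , N , R , Mα ++ E , R ++ Mα , record
          { concat≡      = trans (cong (_++ E) (concat≡ dα)) (++-assoc (blocksConcat (bs ∷ʳ (N , R))) Mα E)
          ; Ms-nonempty  = Ms-nonempty dα
          ; Ps-nonempty  = Ps-nonempty dα
          ; Ms-maxima    = Ms-maxima dα
          ; Ps-nonmaxima = Ps-nonmaxima dα
          ; Mk-maxima    = All.++⁺ (Mk-maxima dα) E-mx }
        , sym (++-assoc R Mα E)
        , trans (concat≡ dα) (begin
            blocksConcat (bs ∷ʳ (N , R)) ++ Mα ≡⟨ cong (_++ Mα) (blocksConcat-∷ʳ bs (N , R)) ⟩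
            (blocksConcat bs ++ N ++ R) ++ Mα  ≡⟨ solve 4 (λ b n r m → (b ⊕ n ⊕ r) ⊕ m ⊜ b ⊕ n ⊕ r ⊕ m)
                                                    refl (blocksConcat bs) N R Mα ⟩
            blocksConcat bs ++ N ++ R ++ Mα    ∎)
        where open ≡-Reasoning

    split-after-last-block : ∀ α D E → All (λ x → ¬ Mx x) D → All Mx E →
      All Mx (take 1 (α ++ D ++ E)) → ¬ All Mx (α ++ D ++ E) → AfterLastBlock α (D ++ E)
    split-after-last-block α D E D-nmx E-mx head-mx not-all
      with decompose α (take-1-++ α head-mx)
    split-after-last-block α [] E _ E-mx _ not-all | bsα , Mα , dα with initLast bsα
    ... | []               =
      ⊥-elim (not-all (subst (λ l → All Mx (l ++ E)) (sym (concat≡ dα)) (All.++⁺ (Mk-maxima dα) E-mx)))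
    ... | bs ∷ʳ′ (N , R)   = absorbFinalBlock dα E-mx
    split-after-last-block α (d ∷ D) E D-nmx E-mx head-mx _ | bsα , m ∷ Mα , dα =
      newLastBlock dα (λ ()) (λ ()) D-nmx E-mx
    split-after-last-block α (d ∷ D) E D-nmx@(d-nmx ∷ _) E-mx head-mx _ | bsα , [] , dα with initLast bsα
    ... | []               with refl ← concat≡ dα | d-mx ∷ _ ← head-mx = ⊥-elim (d-nmx d-mx)
    ... | bs ∷ʳ′ (N , R)   = extendLastBlock dα D-nmx E-mx

  no-nonMx-after-Mx : ∀ D E Y {y z} W → D ++ E ≡ Y ++ y ∷ z ∷ W →
                      All (λ x → ¬ Mx x) D → All Mx E → Mx y → ¬ Mx z → ⊥
  no-nonMx-after-Mx []      E Y       W eq []            E-mx _    z-nmx =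
    z-nmx (lookup E-mx (subst (_ ∈_) (sym eq) (∈-++⁺ʳ Y (there (here refl)))))
  no-nonMx-after-Mx (d ∷ D) E []      W eq (d-nmx ∷ _)   _    y-mx _ with refl , _ ← ∷-injective eq = d-nmx y-mx
  no-nonMx-after-Mx (d ∷ D) E (_ ∷ Y) W eq (_ ∷ D-nmx) E-mx y-mx z-nmx =
    no-nonMx-after-Mx D E Y W (proj₂ (∷-injective eq)) D-nmx E-mx y-mx z-nmx

  nonMx++Mx-unique : ∀ P₁ M₁ P₂ M₂ → P₁ ++ M₁ ≡ P₂ ++ M₂ → All (λ x → ¬ Mx x) P₁ → All Mx M₁ →
                     All (λ x → ¬ Mx x) P₂ → All Mx M₂ → P₁ ≡ P₂ × M₁ ≡ M₂
  nonMx++Mx-unique []       M₁ []       M₂ eq _ _ _ _ = refl , eq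
  nonMx++Mx-unique []       M₁ (p ∷ P₂) M₂ refl _ (p-mx ∷ _) (p-nmx ∷ _) _ = ⊥-elim (p-nmx p-mx)
  nonMx++Mx-unique (p ∷ P₁) M₁ []       M₂ refl (p-nmx ∷ _) _ _ (p-mx ∷ _) = ⊥-elim (p-nmx p-mx)
  nonMx++Mx-unique (p ∷ P₁) M₁ (_ ∷ P₂) M₂ eq (_ ∷ P₁-nmx) M₁-mx (_ ∷ P₂-nmx) M₂-mx
    with refl , eq′ ← ∷-injective eq
    with refl , refl ← nonMx++Mx-unique P₁ M₁ P₂ M₂ eq′ P₁-nmx M₁-mx P₂-nmx M₂-mx = refl , refl

  -- y is forced to be the last Mx-entry that is followed by a non-Mx-entry.
  last-block-unique : ∀ X₁ y₁ P₁ M₁ X₂ y₂ P₂ M₂ → X₁ ++ y₁ ∷ P₁ ++ M₁ ≡ X₂ ++ y₂ ∷ P₂ ++ M₂ →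
    Mx y₁ → P₁ ≢ [] → All (λ x → ¬ Mx x) P₁ → All Mx M₁ →
    Mx y₂ → P₂ ≢ [] → All (λ x → ¬ Mx x) P₂ → All Mx M₂ →
    X₁ ≡ X₂ × y₁ ≡ y₂ × P₁ ≡ P₂ × M₁ ≡ M₂
  last-block-unique [] y₁ P₁ M₁ [] y₂ P₂ M₂ eq _ _ P₁-nmx M₁-mx _ _ P₂-nmx M₂-mx
    with refl , eq′ ← ∷-injective eq
    with refl , refl ← nonMx++Mx-unique P₁ M₁ P₂ M₂ eq′ P₁-nmx M₁-mx P₂-nmx M₂-mx = refl , refl , refl , refl
  last-block-unique [] y₁ P₁ M₁ (_ ∷ X₂) y₂ [] M₂ _ _ _ _ _ _ P₂≢[] _ _ = ⊥-elim (P₂≢[] refl)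
  last-block-unique [] y₁ P₁ M₁ (_ ∷ X₂) y₂ (p ∷ P₂) M₂ eq _ _ P₁-nmx M₁-mx y₂-mx _ (p-nmx ∷ _) _ =
    ⊥-elim (no-nonMx-after-Mx P₁ M₁ X₂ (P₂ ++ M₂) (proj₂ (∷-injective eq)) P₁-nmx M₁-mx y₂-mx p-nmx)
  last-block-unique (_ ∷ X₁) y₁ [] M₁ [] y₂ P₂ M₂ _ _ P₁≢[] _ _ _ _ _ _ = ⊥-elim (P₁≢[] refl)
  last-block-unique (_ ∷ X₁) y₁ (p ∷ P₁) M₁ [] y₂ P₂ M₂ eq y₁-mx _ (p-nmx ∷ _) _ _ _ P₂-nmx M₂-mx =
    ⊥-elim (no-nonMx-after-Mx P₂ M₂ X₁ (P₁ ++ M₁) (sym (proj₂ (∷-injective eq))) P₂-nmx M₂-mx y₁-mx p-nmx)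
  last-block-unique (_ ∷ X₁) y₁ P₁ M₁ (_ ∷ X₂) y₂ P₂ M₂ eq y₁-mx P₁≢[] P₁-nmx M₁-mx y₂-mx P₂≢[] P₂-nmx M₂-mx
    with refl , eq′ ← ∷-injective eq
    with refl , refl , refl , refl ← last-block-unique X₁ y₁ P₁ M₁ X₂ y₂ P₂ M₂ eq′
           y₁-mx P₁≢[] P₁-nmx M₁-mx y₂-mx P₂≢[] P₂-nmx M₂-mx = refl , refl , refl , refl

  nonMx++Mx-suffix : ∀ R Ns u v → All (λ x → ¬ Mx x) R → All Mx Ns → R ++ Ns ≡ u ++ v →
                     ∃[ D ] ∃[ E ] (v ≡ D ++ E × All (λ x → ¬ Mx x) D × All Mx E)
  nonMx++Mx-suffix R       Ns []      v R-nmx        Ns-mx eq = R , Ns , sym eq , R-nmx , Ns-mx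
  nonMx++Mx-suffix []      Ns (a ∷ u) v []           Ns-mx eq =
    [] , v , refl , [] , All.++⁻ʳ (a ∷ u) (subst (All Mx) eq Ns-mx)
  nonMx++Mx-suffix (r ∷ R) Ns (a ∷ u) v (_ ∷ R-nmx)  Ns-mx eq =
    nonMx++Mx-suffix R Ns u v R-nmx Ns-mx (proj₂ (∷-injective eq))

toLTRDecomp : ∀ {L bs Mk} → Blocks.IsBlockDecomposition (_∈ ltrMax L) L bs Mk → LTRDecomp L bs Mk
toLTRDecomp d = record
  { concat≡ = concat≡ ; Ms-nonempty = Ms-nonempty ; Ps-nonempty = Ps-nonempty
  ; Ms-maxima = Ms-maxima ; Ps-nonmaxima = Ps-nonmaxima ; Mk-maxima = Mk-maxima }
  where open Blocks.IsBlockDecomposition d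

≢[]⇒∷ : ∀ (xs : List ℕ) → xs ≢ [] → ∃[ y ] ∃[ ys ] xs ≡ y ∷ ys
≢[]⇒∷ []       xs≢[] = ⊥-elim (xs≢[] refl)
≢[]⇒∷ (y ∷ ys) _     = y , ys , refl

q-largest-last : ∀ α y β → 0 < y → Unique (α ++ y ∷ β) → All (_< y) α → All (_< y) β →
                 q (α ++ y ∷ β) ≡ qsOnto 0 α β ∷ʳ y
q-largest-last α y β 0<y u α<y β<y = trans (q≡qs _ u) (qs-largest-last 0 α y β 0<y α<y β<y)

IsPerm-split-max : ∀ {n} α β → IsPerm n (α ++ n ∷ β) → All (_< n) α × All (_< n) β
IsPerm-split-max {n} α β p =
  tabulate (λ x∈ → below (∈-++⁺ˡ x∈) λ { refl → proj₁ n∉ x∈ }) ,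
  tabulate (λ x∈ → below (∈-++⁺ʳ α (there x∈)) λ { refl → proj₂ n∉ x∈ })
  where
  n∉ : n ∉ α × n ∉ β
  n∉ = Unique-middle α (IsPerm⇒Unique p)
  below : ∀ {x} → x ∈ α ++ n ∷ β → x ≢ n → x < n
  below x∈ = ≤∧≢⇒< (proj₂ (IsPerm-∈ p x∈))

ltrMax-head : ∀ xs → All (0 <_) xs → All (_∈ ltrMax xs) (take 1 xs)
ltrMax-head []       _         = []
ltrMax-head (x ∷ xs) (0<x ∷ _) rewrite <⇒<ᵇ≡true 0<x = here refl ∷ []

ltrMax-next : ∀ A y z B → Unique (A ++ y ∷ z ∷ B) → y ∈ ltrMax (A ++ y ∷ z ∷ B) → y < z →
              z ∈ ltrMax (A ++ y ∷ z ∷ B)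
ltrMax-next A y z B u y-max y<z = subst (λ l → z ∈ ltrMax l) (++-assoc A (y ∷ []) (z ∷ B))
  (>runMax⇒∈ltrMaxFrom 0 (A ∷ʳ y) z B (subst (_< z) (sym runMax≡y) y<z))
  where
  runMax≡y : runMax 0 (A ∷ʳ y) ≡ y
  runMax≡y rewrite runMax-++ 0 A (y ∷ []) | <⇒<ᵇ≡true (∈ltrMaxFrom⇒>runMax 0 A y (z ∷ B) u y-max) = refl

last-record-is-max : ∀ {n} F z → n ≥ 1 → IsPerm n (F ∷ʳ z) → z ∈ ltrMax (F ∷ʳ z) → z ≡ n
last-record-is-max {n} F z n≥1 p z-max with ∈-++⁻ F (IsPerm-max∈ n≥1 p)
... | inj₁ n∈F       =
  ⊥-elim (<⇒≱ (≤-<-trans (runMax-upper 0 F n∈F) runMax<z) (proj₂ (IsPerm-∈ p (∈-insert F))))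
  where
  runMax<z : runMax 0 F < z
  runMax<z = ∈ltrMaxFrom⇒>runMax 0 F z [] (IsPerm⇒Unique p) z-max
... | inj₂ (here n≡z) = sym n≡z

final-maxima-end-with-max : ∀ {n} Y Mk → n ≥ 1 → IsPerm n (Y ++ Mk) → Mk ≢ [] →
                            All (_∈ ltrMax (Y ++ Mk)) Mk → Mk ≡ delete n Mk ∷ʳ n
final-maxima-end-with-max {n} Y Mk n≥1 p Mk≢[] Mk-max with initLast Mk
... | []         = ⊥-elim (Mk≢[] refl)
... | Mk′ ∷ʳ′ z  = ends-with-max (last-record-is-max (Y ++ Mk′) z n≥1 p′ z-max)
  where
  Y++Mk≡ : Y ++ Mk′ ∷ʳ z ≡ (Y ++ Mk′) ∷ʳ z
  Y++Mk≡ = sym (++-assoc Y Mk′ (z ∷ []))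
  p′ : IsPerm n ((Y ++ Mk′) ∷ʳ z)
  p′ = subst (IsPerm n) Y++Mk≡ p
  z-max : z ∈ ltrMax ((Y ++ Mk′) ∷ʳ z)
  z-max = subst (λ l → z ∈ ltrMax l) Y++Mk≡ (proj₂ (All.∷ʳ⁻ Mk-max))
  ends-with-max : z ≡ n → Mk′ ∷ʳ z ≡ delete n (Mk′ ∷ʳ z) ∷ʳ n
  ends-with-max refl =
    cong (_∷ʳ n) (sym (delete-last n Mk′ λ n∈ →
      proj₁ (Unique-middle (Y ++ Mk′) (IsPerm⇒Unique p′)) (∈-++⁺ʳ Y n∈)))

ltrMaxFrom-dominated++ascending : ∀ m D E → All (_≤ m) D → Ascending m E → ltrMaxFrom m (D ++ E) ≡ E
ltrMaxFrom-dominated++ascending m D E D≤m asc rewrite ltrMaxFrom-++ m D E | ltrMaxFrom-dominated m D D≤m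
  | runMax-dominated m D D≤m = ltrMaxFrom-ascending asc

ltrMaxFrom-suffix : ∀ m α v {x} → Unique (α ++ v) → x ∈ v →
                    x ∈ ltrMaxFrom m (α ++ v) ⇔ x ∈ ltrMaxFrom (runMax m α) v
ltrMaxFrom-suffix m α v u x∈v rewrite ltrMaxFrom-++ m α v = mk⇔ to (∈-++⁺ʳ (ltrMaxFrom m α))
  where
  to : _ → _
  to x∈ with ∈-++⁻ (ltrMaxFrom m α) x∈
  ... | inj₁ x∈α = ⊥-elim (Unique-++-disjoint α u (ltrMaxFrom-⊆ m α x∈α) x∈v)
  ... | inj₂ x∈′ = x∈′

ltrMax-block-shape : ∀ Y y D E → Unique (Y ++ y ∷ D ++ E) →
                     0 < y → All (_< y) Y → All (_≤ y) D → Ascending y E →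
                     y ∈ ltrMax (Y ++ y ∷ D ++ E) × All (_∉ ltrMax (Y ++ y ∷ D ++ E)) D
                                                  × All (_∈ ltrMax (Y ++ y ∷ D ++ E)) E
ltrMax-block-shape Y y D E u 0<y Y<y D≤y asc =
  >runMax⇒∈ltrMaxFrom 0 Y y (D ++ E) (runMax-closed 0 Y 0<y Y<y) ,
  tabulate (λ d∈ → subst (λ l → _ ∉ ltrMax l) (sym L≡) (≤runMax⇒∉ltrMaxFrom 0 (Y ∷ʳ y) (D ++ E) (subst Unique L≡ u)
    (∈-++⁺ˡ d∈) (≤-trans (lookup D≤y d∈) (runMax-upper 0 (Y ∷ʳ y) (∈-++⁺ʳ Y (here refl)))))) ,
  tabulate (λ e∈ → subst (λ l → _ ∈ ltrMax l) L≡′ (subst (_ ∈_) (sym (ltrMaxFrom-++ 0 (Y ++ y ∷ D) E))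
    (∈-++⁺ʳ (ltrMax (Y ++ y ∷ D)) (subst (_ ∈_) (sym (ltrMaxFrom-ascending (Ascending-weaken M≤y asc))) e∈))))
  where
  L≡ : Y ++ y ∷ D ++ E ≡ (Y ∷ʳ y) ++ D ++ E
  L≡ = sym (++-assoc Y (y ∷ []) (D ++ E))
  L≡′ : (Y ++ y ∷ D) ++ E ≡ Y ++ y ∷ D ++ E
  L≡′ = ++-assoc Y (y ∷ D) E
  M≤y : runMax 0 (Y ++ y ∷ D) ≤ y
  M≤y = runMax-closed 0 (Y ++ y ∷ D) z≤n (All.++⁺ (All.map <⇒≤ Y<y) (≤-refl ∷ D≤y))

ascending-no-descent : ∀ {m} D E Y {y z} W → D ++ E ≡ Y ++ y ∷ z ∷ W →
                       All (_≤ m) D → Ascending m E → m < y → y < z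
ascending-no-descent []      E Y W refl [] asc _ = pair Y asc
  where
  pair : ∀ {m y z W} Y → Ascending m (Y ++ y ∷ z ∷ W) → y < z
  pair []      (_ ∷ y<z ∷ _) = y<z
  pair (_ ∷ Y) (_ ∷ asc)     = pair Y asc
ascending-no-descent (d ∷ D) E []      W eq (d≤m ∷ _) _ m<y with refl , _ ← ∷-injective eq =
  ⊥-elim (<⇒≱ m<y d≤m)
ascending-no-descent (d ∷ D) E (_ ∷ Y) W eq (_ ∷ D≤m) asc m<y =
  ascending-no-descent D E Y W (proj₂ (∷-injective eq)) D≤m asc m<y

-- β split at its last record (over the running maximum m) that is followed by a smaller entry.
data LastDescent (m : ℕ) (β : List ℕ) : Set where
  descent    : ∀ β₁ y D E → β ≡ β₁ ++ y ∷ D ++ E → runMax m β₁ < y →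
               D ≢ [] → All (_≤ y) D → Ascending y E → LastDescent m β
  no-descent : ∀ D E → β ≡ D ++ E → All (_≤ m) D → Ascending m E → LastDescent m β

lastDescent : ∀ m β → LastDescent m β
lastDescent m []      = no-descent [] [] refl [] []
lastDescent m (z ∷ β) with m <ᵇ z in eq | lastDescent m β | lastDescent z β
... | false | descent β₁ y D E β≡ lt D≢[] D≤ asc | _ =
  descent (z ∷ β₁) y D E (cong (z ∷_) β≡) (subst (_< y) (sym (runMax-skip β₁ eq)) lt) D≢[] D≤ asc
  where
  runMax-skip : ∀ xs → (m <ᵇ z) ≡ false → runMax m (z ∷ xs) ≡ runMax m xs
  runMax-skip xs eq rewrite eq = refl
... | false | no-descent D E β≡ D≤ asc | _ = no-descent (z ∷ D) E (cong (z ∷_) β≡) (<ᵇ≡false⇒≥ eq ∷ D≤) asc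
... | true | _ | descent β₁ y D E β≡ lt D≢[] D≤ asc =
  descent (z ∷ β₁) y D E (cong (z ∷_) β≡) (subst (_< y) (sym (runMax-record β₁ eq)) lt) D≢[] D≤ asc
  where
  runMax-record : ∀ xs → (m <ᵇ z) ≡ true → runMax m (z ∷ xs) ≡ runMax z xs
  runMax-record xs eq rewrite eq = refl
... | true | _ | no-descent []      E β≡ [] asc =
  no-descent [] (z ∷ E) (cong (z ∷_) β≡) [] (<ᵇ≡true⇒< eq ∷ asc)
... | true | _ | no-descent (d ∷ D) E β≡ D≤ asc =
  descent [] z (d ∷ D) E (cong (z ∷_) β≡) (<ᵇ≡true⇒< eq) (λ ()) D≤ asc

ExactlyOne-intro : ∀ {A B : Set} → (A → B → ⊥) → A ⊎ B → ExactlyOne A B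
ExactlyOne-intro disjoint (inj₁ a) = inj₁ (a , disjoint a)
ExactlyOne-intro disjoint (inj₂ b) = inj₂ ((λ a → disjoint a b) , b)

-- Preimages of π

module LastMaxBlock {n : ℕ} (n≥1 : n ≥ 1) {π : List ℕ} (π-perm : IsPerm n π)
                   {bs : List (List ℕ × List ℕ)} {Mk : List ℕ} (dπ : LTRDecomp π bs Mk) (Mk≢[] : Mk ≢ [])
                   {bs₀ : List (List ℕ × List ℕ)} {M′ : List ℕ} {μ : ℕ} {P : List ℕ}
                   (bs≡ : bs ≡ bs₀ ∷ʳ (M′ ∷ʳ μ , P)) where

  open LTRDecomp dπ
  open ++-Solver
  open ≡-Reasoning

  X Mk₀ π₀ : List ℕ
  X  = blocksConcat bs₀ ++ M′
  Mk₀ = delete n Mk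
  π₀ = X ++ μ ∷ P ++ Mk₀

  lastBlock : ∀ {A : List ℕ × List ℕ → Set} → All A bs → A (M′ ∷ʳ μ , P)
  lastBlock A-bs = proj₂ (All.∷ʳ⁻ (subst (All _) bs≡ A-bs))

  π≡ : π ≡ X ++ μ ∷ P ++ Mk
  π≡ = begin
    π                                                ≡⟨ concat≡ ⟩
    blocksConcat bs ++ Mk                            ≡⟨ cong (λ b → blocksConcat b ++ Mk) bs≡ ⟩
    blocksConcat (bs₀ ∷ʳ (M′ ∷ʳ μ , P)) ++ Mk        ≡⟨ cong (_++ Mk) (blocksConcat-∷ʳ bs₀ (M′ ∷ʳ μ , P)) ⟩
    (blocksConcat bs₀ ++ (M′ ∷ʳ μ) ++ P) ++ Mk       ≡⟨ solve 5 (λ b m x p k → (b ⊕ (m ⊕ x) ⊕ p) ⊕ k ⊜ (b ⊕ m) ⊕ x ⊕ p ⊕ k)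
                                                           refl (blocksConcat bs₀) M′ (μ ∷ []) P Mk ⟩
    X ++ μ ∷ P ++ Mk                                 ∎

  π-unique : Unique (X ++ μ ∷ P ++ Mk)
  π-unique = subst Unique π≡ (IsPerm⇒Unique π-perm)

  μ-max : μ ∈ ltrMax π
  μ-max = proj₂ (All.∷ʳ⁻ (lastBlock {λ b → All (_∈ ltrMax π) (proj₁ b)} Ms-maxima))

  0<μ : 0 < μ
  0<μ = proj₁ (IsPerm-∈ π-perm (subst (μ ∈_) (sym π≡) (∈-++⁺ʳ X (here refl))))

  P≢[] : P ≢ []
  P≢[] = lastBlock Ps-nonempty

  P-nonmax : All (_∉ ltrMax π) P
  P-nonmax = lastBlock Ps-nonmaxima

  X<μ : All (_< μ) X
  X<μ = tabulate λ x∈ → ≤-<-trans (runMax-upper 0 X x∈)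
    (∈ltrMaxFrom⇒>runMax 0 X μ (P ++ Mk) π-unique (subst (λ l → μ ∈ ltrMax l) π≡ μ-max))

  Mk≡ : Mk ≡ Mk₀ ∷ʳ n
  Mk≡ = final-maxima-end-with-max (X ++ μ ∷ P) Mk n≥1 (subst (IsPerm n) π≡′ π-perm) Mk≢[]
          (subst (λ l → All (_∈ ltrMax l) Mk) π≡′ Mk-maxima)
    where
    π≡′ : π ≡ (X ++ μ ∷ P) ++ Mk
    π≡′ = trans π≡ (solve 4 (λ x m p k → x ⊕ m ⊕ p ⊕ k ⊜ (x ⊕ m ⊕ p) ⊕ k) refl X (μ ∷ []) P Mk)

  π≡π₀∷ʳn : π ≡ π₀ ∷ʳ n
  π≡π₀∷ʳn = begin
    π                            ≡⟨ π≡ ⟩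
    X ++ μ ∷ P ++ Mk             ≡⟨ cong (λ k → X ++ μ ∷ P ++ k) Mk≡ ⟩
    X ++ μ ∷ P ++ (Mk₀ ∷ʳ n)     ≡⟨ solve 5 (λ x m p k z → x ⊕ m ⊕ p ⊕ (k ⊕ z) ⊜ (x ⊕ m ⊕ p ⊕ k) ⊕ z)
                                      refl X (μ ∷ []) P Mk₀ (n ∷ []) ⟩
    π₀ ∷ʳ n                      ∎

  π₀-unique : Unique (π₀ ∷ʳ n)
  π₀-unique = subst Unique π≡π₀∷ʳn (IsPerm⇒Unique π-perm)

  delete-π : delete n π ≡ π₀
  delete-π = trans (cong (delete n) π≡π₀∷ʳn) (delete-last n π₀ (proj₁ (Unique-middle π₀ π₀-unique)))

  P-head : ∃[ p ] ∃[ P′ ] P ≡ p ∷ P′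
  P-head = ≢[]⇒∷ P P≢[]

  μ≮P-head : ∀ {p P′} → P ≡ p ∷ P′ → ¬ μ < p
  μ≮P-head {p} {P′} P≡ μ<p = lookup P-nonmax (subst (p ∈_) (sym P≡) (here refl))
    (subst (λ l → p ∈ ltrMax l) (sym π≡′) (ltrMax-next X μ p (P′ ++ Mk) (subst Unique π≡″ π-unique)
      (subst (λ l → μ ∈ ltrMax l) π≡′ μ-max) μ<p))
    where
    π≡″ : X ++ μ ∷ P ++ Mk ≡ X ++ μ ∷ p ∷ P′ ++ Mk
    π≡″ = cong (λ l → X ++ μ ∷ l ++ Mk) P≡
    π≡′ : π ≡ X ++ μ ∷ p ∷ P′ ++ Mk
    π≡′ = trans π≡ π≡″

  π₀-not-ascending : ¬ All (_∈ ltrMax π₀) π₀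
  π₀-not-ascending all-max with p , P′ , P≡ ← P-head = lookup P-nonmax p∈P
    (subst (λ l → p ∈ ltrMax l) (sym π≡π₀∷ʳn) (subst (p ∈_) (sym (ltrMaxFrom-++ 0 π₀ (n ∷ [])))
      (∈-++⁺ˡ (lookup all-max (∈-++⁺ʳ X (there (∈-++⁺ˡ p∈P)))))))
    where
    p∈P : p ∈ P
    p∈P = subst (p ∈_) (sym P≡) (here refl)

  module Preimages {σ : List ℕ} (σ-perm : IsPerm n σ) where

    ViaPrefix : Set
    ViaPrefix = ∃[ τ ] (τ ↭ (X ∷ʳ n) × q (std τ) ≡ std (X ∷ʳ n) × σ ≡ τ ++ μ ∷ P ++ Mk₀)

    ViaInsertion : Set
    ViaInsertion = ∃[ σ′ ] (IsPerm (n ∸ 1) σ′ × q σ′ ≡ delete n π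
      × ∃[ cs ] ∃[ Ns ] (LTRDecomp σ′ cs Ns
      × ∃[ cs₀ ] ∃[ N ] ∃[ R ] (cs ≡ cs₀ ∷ʳ (N , R)
      × ∃[ u ] ∃[ v ] (R ++ Ns ≡ u ++ v
      × σ ≡ blocksConcat cs₀ ++ N ++ u ++ n ∷ v))))

    -- σ = α n β with q σ = π; PrefixSplit and InsertionSplit are the two shapes of β behind
    -- cases (1) and (2).
    record Split : Set where
      field
        α β       : List ℕ
        σ≡        : σ ≡ α ++ n ∷ β
        qsOnto≡π₀ : qsOnto 0 α β ≡ π₀

    record PrefixSplit : Set where
      field
        α β      : List ℕ
        σ≡       : σ ≡ α ++ n ∷ β ++ μ ∷ P ++ Mk₀
        qsOnto≡X : qsOnto 0 α β ≡ X

    record InsertionSplit : Set where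
      field
        α D E       : List ℕ
        σ≡          : σ ≡ α ++ n ∷ D ++ E
        qsOnto≡π₀   : qsOnto 0 α (D ++ E) ≡ π₀
        D-below     : All (_≤ runMax 0 α) D
        E-ascending : Ascending (runMax 0 α) E

    σ-unique : Unique σ
    σ-unique = IsPerm⇒Unique σ-perm

    below-n : ∀ α β → σ ≡ α ++ n ∷ β → All (_< n) α × All (_< n) β
    below-n α β σ≡ = IsPerm-split-max α β (subst (IsPerm n) σ≡ σ-perm)

    q-σ : ∀ α β → σ ≡ α ++ n ∷ β → q σ ≡ qsOnto 0 α β ∷ʳ n
    q-σ α β σ≡ = trans (cong q σ≡)
      (q-largest-last α n β n≥1 (subst Unique σ≡ σ-unique) (proj₁ (below-n α β σ≡)) (proj₂ (below-n α β σ≡)))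

    split⇒preimage : Split → q σ ≡ π
    split⇒preimage s = trans (q-σ α β σ≡) (trans (cong (_∷ʳ n) qsOnto≡π₀) (sym π≡π₀∷ʳn))
      where open Split s

    preimage⇒split : q σ ≡ π → Split
    preimage⇒split qσ≡π with α , β , σ≡ ← ∈-∃++ (IsPerm-max∈ n≥1 σ-perm) = record
      { α = α ; β = β ; σ≡ = σ≡
      ; qsOnto≡π₀ = ∷ʳ-injectiveˡ (qsOnto 0 α β) π₀ (trans (sym (q-σ α β σ≡)) (trans qσ≡π π≡π₀∷ʳn)) }

    below-μ : ∀ α β → qsOnto 0 α β ≡ X → All (_< μ) (α ++ β)
    below-μ α β qsOnto≡X = tabulate λ x∈ →
      lookup X<μ (subst (_ ∈_) qsOnto≡X (Perm.∈-resp-↭ (↭-sym (qsOnto-↭ 0 α β)) x∈))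

    prefixSplit⇒split : PrefixSplit → Split
    prefixSplit⇒split s = record
      { α = α ; β = β ++ μ ∷ P ++ Mk₀ ; σ≡ = σ≡
      ; qsOnto≡π₀ = trans (qsOnto-++-larger 0 α β (P ++ Mk₀) (All.++⁻ˡ α (below-μ α β qsOnto≡X)))
                          (cong (_++ μ ∷ P ++ Mk₀) qsOnto≡X) }
      where open PrefixSplit s

    -- Inside τ = α n β the entry n is the largest, so q τ = qsOnto 0 α β n; standardisation
    -- commutes with q, so the hypothesis on std τ says exactly that qsOnto 0 α β = X.
    prefixSplit⇔viaPrefix : PrefixSplit ⇔ ViaPrefix
    prefixSplit⇔viaPrefix = mk⇔ to from
      where
      module _ (α β : List ℕ) (σ≡ : σ ≡ (α ++ n ∷ β) ++ μ ∷ P ++ Mk₀) where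
        τ-unique : Unique (α ++ n ∷ β)
        τ-unique = Unique-++⁻ˡ (α ++ n ∷ β) (subst Unique σ≡ σ-unique)

        σ≡′ : σ ≡ α ++ n ∷ β ++ μ ∷ P ++ Mk₀
        σ≡′ = trans σ≡ (++-assoc α (n ∷ β) _)

        qτ≡ : q (α ++ n ∷ β) ≡ qsOnto 0 α β ∷ʳ n
        qτ≡ = q-largest-last α n β n≥1 τ-unique (proj₁ (below-n _ _ σ≡′)) (All.++⁻ˡ β (proj₂ (below-n _ _ σ≡′)))

        τ-positive : All (0 <_) (α ++ n ∷ β)
        τ-positive = tabulate λ x∈ → proj₁ (IsPerm-∈ σ-perm (subst (_ ∈_) (sym σ≡) (∈-++⁺ˡ x∈)))

      to : PrefixSplit → ViaPrefix
      to record { α = α ; β = β ; σ≡ = σ≡ ; qsOnto≡X = qsOnto≡X } =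
        α ++ n ∷ β , τ↭ , trans (q-std τ (τ-unique α β σ≡τ) (τ-positive α β σ≡τ)) (cong std qτ≡X) , σ≡τ
        where
        τ = α ++ n ∷ β
        σ≡τ : σ ≡ τ ++ μ ∷ P ++ Mk₀
        σ≡τ = trans σ≡ (sym (++-assoc α (n ∷ β) _))
        qτ≡X : q τ ≡ X ∷ʳ n
        qτ≡X = trans (qτ≡ α β σ≡τ) (cong (_∷ʳ n) qsOnto≡X)
        τ↭ : τ ↭ X ∷ʳ n
        τ↭ = ↭-trans (Perm.shift n α β) (↭-trans (Perm.++-comm (n ∷ []) (α ++ β))
               (subst (λ l → (α ++ β) ∷ʳ n ↭ l ∷ʳ n) qsOnto≡X (Perm.++⁺ʳ (n ∷ []) (↭-sym (qsOnto-↭ 0 α β)))))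

      from : ViaPrefix → PrefixSplit
      from (τ , τ↭ , q-std-τ , σ≡) = split-τ (∈-∃++ (Perm.∈-resp-↭ (↭-sym τ↭) (∈-++⁺ʳ X (here refl))))
        where
        split-τ : ∃[ α ] ∃[ β ] τ ≡ α ++ n ∷ β → PrefixSplit
        split-τ (α , β , refl) = record
          { α = α ; β = β ; σ≡ = σ≡′ α β σ≡
          ; qsOnto≡X = ∷ʳ-injectiveˡ (qsOnto 0 α β) X (trans (sym (qτ≡ α β σ≡)) qτ≡X) }
          where
          qτ≡X : q τ ≡ X ∷ʳ n
          qτ≡X = std-injective τ (q τ) (X ∷ʳ n) (τ-unique α β σ≡) (q-↭ (τ-unique α β σ≡)) (↭-sym τ↭)
                   (trans (sym (q-std τ (τ-unique α β σ≡) (τ-positive α β σ≡))) q-std-τ)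

    insertionSplit⇒split : InsertionSplit → Split
    insertionSplit⇒split s = record { α = α ; β = D ++ E ; σ≡ = σ≡ ; qsOnto≡π₀ = qsOnto≡π₀ }
      where open InsertionSplit s

    insertionSplit⇔viaInsertion : InsertionSplit ⇔ ViaInsertion
    insertionSplit⇔viaInsertion = mk⇔ to from
      where
      to : InsertionSplit → ViaInsertion
      to record { α = α ; D = D ; E = E ; σ≡ = σ≡ ; qsOnto≡π₀ = qsOnto≡π₀ ; D-below = D≤ ; E-ascending = asc } =
        assemble (Blocks.split-after-last-block (_∈ ltrMax σ′) (_∈? ltrMax σ′) α D E D-nonmax E-max
                    (ltrMax-head σ′ (tabulate λ x∈ → proj₁ (IsPerm-∈ σ′-perm x∈))) not-ascending)
        where
        σ′ = α ++ D ++ E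
        n∉ : n ∉ α × n ∉ D ++ E
        n∉ = Unique-middle α (subst Unique σ≡ σ-unique)
        σ′-perm : IsPerm (n ∸ 1) σ′
        σ′-perm = subst (IsPerm (n ∸ 1)) (delete-middle n α (D ++ E) (proj₁ n∉) (proj₂ n∉))
                    (IsPerm-delete (subst (IsPerm n) σ≡ σ-perm))
        σ′-unique : Unique σ′
        σ′-unique = IsPerm⇒Unique σ′-perm
        qs-σ′ : qs 0 σ′ ≡ π₀
        qs-σ′ = trans (qs-dominated-tail 0 α D E D≤ asc) qsOnto≡π₀
        D-nonmax : All (_∉ ltrMax σ′) D
        D-nonmax = tabulate λ d∈ → ≤runMax⇒∉ltrMaxFrom 0 α (D ++ E) σ′-unique (∈-++⁺ˡ d∈) (lookup D≤ d∈)
        E-max : All (_∈ ltrMax σ′) E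
        E-max = tabulate λ e∈ → subst (_ ∈_) (sym (ltrMaxFrom-++ 0 α (D ++ E)))
          (∈-++⁺ʳ (ltrMax α) (subst (_ ∈_) (sym (ltrMaxFrom-dominated++ascending _ D E D≤ asc)) e∈))
        -- Were σ′ ascending, q would fix it and σ′ = π₀, which has a non-maximum.
        not-ascending : ¬ All (_∈ ltrMax σ′) σ′
        not-ascending all-max = π₀-not-ascending (subst (λ l → All (_∈ ltrMax l) l)
          (trans (sym (qs-ascending (proj₂ (nonRecords++records 0 [] σ′ σ′-unique [] all-max)))) qs-σ′) all-max)
        assemble : Blocks.AfterLastBlock (_∈ ltrMax σ′) (_∈? ltrMax σ′) α (D ++ E) → ViaInsertion
        assemble (cs₀ , N , R , Ns , u , dσ′ , R++Ns≡ , α≡) =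
          σ′ , σ′-perm , trans (q≡qs σ′ σ′-unique) (trans qs-σ′ (sym delete-π)) ,
          cs₀ ∷ʳ (N , R) , Ns , toLTRDecomp dσ′ , cs₀ , N , R , refl , u , D ++ E , R++Ns≡ ,
          trans σ≡ (trans (cong (_++ n ∷ D ++ E) α≡)
            (solve 4 (λ b k u w → (b ⊕ k ⊕ u) ⊕ w ⊜ b ⊕ k ⊕ u ⊕ w) refl (blocksConcat cs₀) N u (n ∷ D ++ E)))

      from : ViaInsertion → InsertionSplit
      from (σ′ , σ′-perm , qσ′≡ , cs , Ns , dσ′ , cs₀ , N , R , refl , u , v , R++Ns≡ , σ≡) =
        split-v (Blocks.nonMx++Mx-suffix (_∈ ltrMax σ′) R Ns u v (proj₂ (All.∷ʳ⁻ (LTRDecomp.Ps-nonmaxima dσ′)))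
                   (LTRDecomp.Mk-maxima dσ′) R++Ns≡)
        where
        α = blocksConcat cs₀ ++ N ++ u
        σ′≡ : σ′ ≡ α ++ v
        σ′≡ = begin
          σ′                                   ≡⟨ LTRDecomp.concat≡ dσ′ ⟩
          blocksConcat (cs₀ ∷ʳ (N , R)) ++ Ns  ≡⟨ cong (_++ Ns) (blocksConcat-∷ʳ cs₀ (N , R)) ⟩
          (blocksConcat cs₀ ++ N ++ R) ++ Ns   ≡⟨ solve 4 (λ b k r s → (b ⊕ k ⊕ r) ⊕ s ⊜ b ⊕ k ⊕ r ⊕ s)
                                                    refl (blocksConcat cs₀) N R Ns ⟩
          blocksConcat cs₀ ++ N ++ R ++ Ns     ≡⟨ cong (λ l → blocksConcat cs₀ ++ N ++ l) R++Ns≡ ⟩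
          blocksConcat cs₀ ++ N ++ u ++ v      ≡⟨ solve 4 (λ b k u v → b ⊕ k ⊕ u ⊕ v ⊜ (b ⊕ k ⊕ u) ⊕ v)
                                                    refl (blocksConcat cs₀) N u v ⟩
          α ++ v                               ∎
        split-v : ∃[ D ] ∃[ E ] (v ≡ D ++ E × All (_∉ ltrMax σ′) D × All (_∈ ltrMax σ′) E) → InsertionSplit
        split-v (D , E , refl , D-nonmax , E-max) = record
          { α = α ; D = D ; E = E
          ; σ≡ = trans σ≡ (solve 4 (λ b k u w → b ⊕ k ⊕ u ⊕ w ⊜ (b ⊕ k ⊕ u) ⊕ w)
                                  refl (blocksConcat cs₀) N u (n ∷ D ++ E))
          ; qsOnto≡π₀ = begin
              qsOnto 0 α (D ++ E)   ≡⟨ sym (qs-dominated-tail 0 α D E D≤ asc) ⟩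
              qs 0 (α ++ D ++ E)    ≡⟨ cong (qs 0) (sym σ′≡) ⟩
              qs 0 σ′               ≡⟨ sym (q≡qs σ′ (IsPerm⇒Unique σ′-perm)) ⟩
              q σ′                  ≡⟨ trans qσ′≡ delete-π ⟩
              π₀                    ∎
          ; D-below = D≤ ; E-ascending = asc }
          where
          αDE-unique : Unique (α ++ D ++ E)
          αDE-unique = subst Unique σ′≡ (IsPerm⇒Unique σ′-perm)
          tail-max : ∀ {x} → x ∈ D ++ E → x ∈ ltrMax σ′ ⇔ x ∈ ltrMaxFrom (runMax 0 α) (D ++ E)
          tail-max {x} x∈ = subst (λ l → x ∈ ltrMax l ⇔ x ∈ ltrMaxFrom (runMax 0 α) (D ++ E)) (sym σ′≡)
                              (ltrMaxFrom-suffix 0 α (D ++ E) αDE-unique x∈)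
          shape : All (_≤ runMax 0 α) D × Ascending (runMax 0 α) E
          shape = nonRecords++records (runMax 0 α) D E (Unique-++⁻ʳ α αDE-unique)
            (tabulate λ d∈ → lookup D-nonmax d∈ ∘ Equivalence.from (tail-max (∈-++⁺ˡ d∈)))
            (tabulate λ e∈ → Equivalence.to (tail-max (∈-++⁺ʳ D e∈)) (lookup E-max e∈))
          D≤ = proj₁ shape
          asc = proj₂ shape

    -- Here π = Y y D (E ∷ʳ n) with Y = qsOnto 0 α β₁, and uniqueness of the last block
    -- identifies Y, y, D, E ∷ʳ n with X, μ, P, Mk.
    descent⇒prefixSplit : ∀ α β → σ ≡ α ++ n ∷ β → qsOnto 0 α β ≡ π₀ →
      ∀ β₁ y D E → β ≡ β₁ ++ y ∷ D ++ E → runMax (runMax 0 α) β₁ < y → D ≢ [] → All (_≤ y) D → Ascending y E →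
      PrefixSplit
    descent⇒prefixSplit α β σ≡ qsOnto≡π₀ β₁ y D E β≡ β₁<y D≢[] D≤y asc =
      conclude (Blocks.last-block-unique (_∈ ltrMax π) X μ P Mk Y y D (E ∷ʳ n)
        (trans (sym π≡) π≡′) μ-max P≢[] P-nonmax Mk-maxima
        (subst (λ l → y ∈ ltrMax l) (sym π≡′) (proj₁ shape)) D≢[]
        (subst (λ l → All (_∉ ltrMax l) D) (sym π≡′) (proj₁ (proj₂ shape)))
        (subst (λ l → All (_∈ ltrMax l) (E ∷ʳ n)) (sym π≡′) (proj₂ (proj₂ shape))))
      where
      Y = qsOnto 0 α β₁
      σ≡′ : σ ≡ α ++ n ∷ β₁ ++ y ∷ D ++ E
      σ≡′ = trans σ≡ (cong (λ l → α ++ n ∷ l) β≡)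
      β<n : All (_< n) (y ∷ D ++ E)
      β<n = All.++⁻ʳ β₁ (proj₂ (below-n α _ σ≡′))
      αβ₁<y : All (_< y) (α ++ β₁)
      αβ₁<y = All.++⁺ (All.map (λ x≤ → ≤-<-trans (≤-trans x≤ (runMax-≥ _ β₁)) β₁<y) (tabulate (runMax-upper 0 α)))
                      (All.map (λ x≤ → ≤-<-trans x≤ β₁<y) (tabulate (runMax-upper _ β₁)))
      Y<y : All (_< y) Y
      Y<y = tabulate λ x∈ → lookup αβ₁<y (Perm.∈-resp-↭ (qsOnto-↭ 0 α β₁) x∈)
      π≡′ : π ≡ Y ++ y ∷ D ++ (E ∷ʳ n)
      π≡′ = begin
        π                                   ≡⟨ π≡π₀∷ʳn ⟩
        π₀ ∷ʳ n                             ≡⟨ cong (_∷ʳ n) (trans (sym qsOnto≡π₀) (cong (qsOnto 0 α) β≡)) ⟩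
        qsOnto 0 α (β₁ ++ y ∷ D ++ E) ∷ʳ n  ≡⟨ cong (_∷ʳ n) (qsOnto-++-larger 0 α β₁ (D ++ E) (All.++⁻ˡ α αβ₁<y)) ⟩
        (Y ++ y ∷ D ++ E) ∷ʳ n              ≡⟨ solve 5 (λ a b d e z → (a ⊕ b ⊕ d ⊕ e) ⊕ z ⊜ a ⊕ b ⊕ d ⊕ e ⊕ z)
                                                  refl Y (y ∷ []) D E (n ∷ []) ⟩
        Y ++ y ∷ D ++ (E ∷ʳ n)              ∎
      shape = ltrMax-block-shape Y y D (E ∷ʳ n) (subst Unique π≡′ (IsPerm⇒Unique π-perm))
                (proj₁ (IsPerm-∈ σ-perm (subst (y ∈_) (sym σ≡′) (∈-++⁺ʳ α (there (∈-++⁺ʳ β₁ (here refl)))))))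
                Y<y D≤y (Ascending-∷ʳ (All.head β<n) (All.++⁻ʳ D (All.tail β<n)) asc)
      conclude : X ≡ Y × μ ≡ y × P ≡ D × Mk ≡ E ∷ʳ n → PrefixSplit
      conclude (X≡Y , μ≡y , P≡D , Mk≡E∷ʳn) = record
        { α = α ; β = β₁
        ; σ≡ = trans σ≡′ (cong₂ (λ z w → α ++ n ∷ β₁ ++ z ∷ w) (sym μ≡y)
                 (cong₂ _++_ (sym P≡D) (sym (∷ʳ-injectiveˡ Mk₀ E (trans (sym Mk≡) Mk≡E∷ʳn)))))
        ; qsOnto≡X = sym X≡Y }

    split-cases : Split → PrefixSplit ⊎ InsertionSplit
    split-cases record { α = α ; β = β ; σ≡ = σ≡ ; qsOnto≡π₀ = qsOnto≡π₀ } with lastDescent (runMax 0 α) β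
    ... | descent β₁ y D E β≡ β₁<y D≢[] D≤y asc =
      inj₁ (descent⇒prefixSplit α β σ≡ qsOnto≡π₀ β₁ y D E β≡ β₁<y D≢[] D≤y asc)
    ... | no-descent D E β≡ D≤ asc = inj₂ record
      { α = α ; D = D ; E = E ; σ≡ = trans σ≡ (cong (λ l → α ++ n ∷ l) β≡)
      ; qsOnto≡π₀ = trans (cong (qsOnto 0 α) (sym β≡)) qsOnto≡π₀ ; D-below = D≤ ; E-ascending = asc }

    -- After n, a prefix split has the maximum μ directly followed by the smaller head of P,
    -- whereas an insertion split has only entries below the running maximum and then an ascending run.
    splits-exclusive : PrefixSplit → InsertionSplit → ⊥
    splits-exclusive record { α = α₁ ; β = β ; σ≡ = σ≡₁ ; qsOnto≡X = qsOnto≡X }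
                     record { α = α ; D = D ; E = E ; σ≡ = σ≡₂ ; D-below = D≤ ; E-ascending = asc }
      with refl , tail≡ ← Unique⇒split-unique α₁ α (subst Unique σ≡₁ σ-unique) (trans (sym σ≡₁) σ≡₂)
         | p , P′ , P≡ ← P-head =
      μ≮P-head P≡ (ascending-no-descent D E β (P′ ++ Mk₀)
        (trans (sym tail≡) (cong (λ l → β ++ μ ∷ l ++ Mk₀) P≡)) D≤ asc
        (runMax-closed 0 α 0<μ (All.++⁻ˡ α (below-μ α β qsOnto≡X))))

theorem3p7 : (n : ℕ) → n ≥ 1 → (π : List ℕ) → IsPerm n π →
  (bs : List (List ℕ × List ℕ)) (Mk : List ℕ) → LTRDecomp π bs Mk →
  Mk ≢ [] → π ≢ idPerm n →
  (bs₀ : List (List ℕ × List ℕ)) (M′ : List ℕ) (μ : ℕ) (P : List ℕ) →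
  bs ≡ bs₀ ∷ʳ (M′ ∷ʳ μ , P) →
  (σ : List ℕ) → IsPerm n σ →
  (q σ ≡ π) ⇔ ExactlyOne
    (∃[ τ ] (τ ↭ ((blocksConcat bs₀ ++ M′) ∷ʳ n)
             × q (std τ) ≡ std ((blocksConcat bs₀ ++ M′) ∷ʳ n)
             × σ ≡ τ ++ μ ∷ P ++ delete n Mk))
    (∃[ σ′ ] (IsPerm (n ∸ 1) σ′ × q σ′ ≡ delete n π
      × ∃[ cs ] ∃[ Ns ] (LTRDecomp σ′ cs Ns
      × ∃[ cs₀ ] ∃[ N ] ∃[ R ] (cs ≡ cs₀ ∷ʳ (N , R)
      × ∃[ u ] ∃[ v ] (R ++ Ns ≡ u ++ v
      × σ ≡ blocksConcat cs₀ ++ N ++ u ++ n ∷ v)))))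
theorem3p7 n n≥1 π π-perm bs Mk dπ Mk≢[] _ bs₀ M′ μ P bs≡ σ σ-perm = mk⇔
  (λ qσ≡π → ExactlyOne-intro exclusive
    (Sum.map (Equivalence.to prefix) (Equivalence.to insertion) (split-cases (preimage⇒split qσ≡π))))
  [ split⇒preimage ∘ prefixSplit⇒split ∘ Equivalence.from prefix ∘ proj₁
  , split⇒preimage ∘ insertionSplit⇒split ∘ Equivalence.from insertion ∘ proj₂ ]
  where
  open LastMaxBlock.Preimages n≥1 π-perm dπ Mk≢[] bs≡ σ-perm
  prefix = prefixSplit⇔viaPrefix
  insertion = insertionSplit⇔viaInsertion
  exclusive : ViaPrefix → ViaInsertion → ⊥
  exclusive c₁ c₂ = splits-exclusive (Equivalence.from prefix c₁) (Equivalence.from insertion c₂)
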